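{- For each $n\ge4$, the Tutte polynomial of $\mathcal{B}_n^\ast$ is $$T(\mathcal{B}_n^\ast;x,y)=\left(y+x+\cdots+x^{2^{\frac{n-1}{2}}-1}\right)^4\left(y+x+\cdots+x^{2^{\frac{n+1}{2}}-1}\right)\prod_{i=1}^{\frac{n-1}{2}-1}\left(y+x+\cdots+x^{2^i-1}\right)^{3\cdot 2^{n-2i-1}}$$ for $n$ odd and $$T(\mathcal{B}_n^\ast;x,y)=\left(y+x+\cdots+x^{2^{\frac{n}{2}}-1}\right)^3\prod_{i=1}^{\frac{n}{2}-1}\left(y+x+\cdots+x^{2^i-1}\right)^{3\cdot 2^{n-2i-1}}$$ for $n$ even. Moreover, $T(\mathcal{B}_1^\ast;x,y)=x+y$, $T(\mathcal{B}_2^\ast;x,y)=(x+y)^3$ and $T(\mathcal{B}_3^\ast;x,y)=(x+y)^4(y+x+x^2+x^3)$.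
   Context: The Basilica group is generated by the automorphisms $a,b$ of the rooted binary tree defined recursively on finite binary words $w$ by $a(0w)=0\,b(w)$, $a(1w)=1w$, $b(0w)=1\,a(w)$, $b(1w)=0w$. For $n\ge1$, the Schreier graph $\mathcal{B}_n$ is the finite multigraph with vertex set $\{0,1\}^n$ having, for each vertex $u$ and each $s\in\{a,b\}$, one edge joining $u$ and $s(u)$ (a loop if $s(u)=u$); $\mathcal{B}_n^\ast$ is obtained from $\mathcal{B}_n$ by deleting all loops. For a finite multigraph $G=(V,E)$, $T(G;x,y)=\sum_{A\subseteq E}(x-1)^{r(E)-r(A)}(y-1)^{|A|-r(A)}$ with $r(A)=|V|-k(A)$, $k(A)$ the number of connected components of $(V,A)$. An expression $y+x+\cdots+x^{m-1}$ means $y+\sum_{j=1}^{m-1}x^j$. -}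

module Defs where

open import Data.Bool using (Bool; true; false; if_then_else_)
open import Data.Bool.Properties using () renaming (_≟_ to _≟B_)
open import Data.Nat as ℕ using (ℕ; zero; suc; _∸_)
open import Data.Integer using (ℤ; _+_; _*_; _-_; _^_; 0ℤ; 1ℤ)
open import Data.List using (List; []; _∷_; _++_; map; concatMap; length; filter; foldl)
open import Data.Vec using (Vec; []; _∷_)
open import Data.Vec.Properties using (≡-dec)
open import Data.Product using (_×_; _,_)
open import Relation.Nullary using (Dec; yes; no; ¬_)
open import Relation.Nullary.Decidable using (⌊_⌋)
open import Relation.Binary.PropositionalEquality using (_≡_)

module Graph {V : Set} (_≟_ : (u v : V) → Dec (u ≡ v)) where

  -- Component labelling (union-find by relabelling): a labelling f maps
  -- each vertex to the representative of its current component.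
  merge : (V → V) → V × V → (V → V)
  merge f (u , v) w = if ⌊ f w ≟ f v ⌋ then f u else f w

  label : List (V × V) → V → V
  label es = foldl merge (λ w → w) es

  -- k(A): number of connected components of (vs , A)
  -- (= number of representatives, i.e. fixed points of the labelling).
  components : List V → List (V × V) → ℕ
  components vs A = length (filter (λ w → label A w ≟ w) vs)

  rank : List V → List (V × V) → ℕ
  rank vs A = length vs ∸ components vs A

  subsets : {X : Set} → List X → List (List X)
  subsets []       = [] ∷ []
  subsets (e ∷ es) = let s = subsets es in s ++ map (e ∷_) s

  sumℤ : List ℤ → ℤ
  sumℤ []       = 0ℤ
  sumℤ (z ∷ zs) = z + sumℤ zs

  tutte : List V → List (V × V) → ℤ → ℤ → ℤ
  tutte vs E x y =
    sumℤ (map (λ A → ((x - 1ℤ) ^ (rank vs E ∸ rank vs A))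
                     * ((y - 1ℤ) ^ (length A ∸ rank vs A)))
              (subsets E))

-- Basilica group and its Schreier graphs (0 = false, 1 = true)

Word : ℕ → Set
Word n = Vec Bool n

mutual
  basA : {n : ℕ} → Word n → Word n
  basA []            = []
  basA (false ∷ w)   = false ∷ basB w
  basA (true  ∷ w)   = true ∷ w

  basB : {n : ℕ} → Word n → Word n
  basB []            = []
  basB (false ∷ w)   = true ∷ basA w
  basB (true  ∷ w)   = false ∷ w

_≟W_ : {n : ℕ} → (u v : Word n) → Dec (u ≡ v)
_≟W_ = ≡-dec _≟B_

allWords : (n : ℕ) → List (Word n)
allWords zero    = [] ∷ []
allWords (suc n) = map (false ∷_) (allWords n) ++ map (true ∷_) (allWords n)

loopless : {n : ℕ} → Word n → Word n → List (Word n × Word n)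
loopless u v with v ≟W u
... | yes _ = []
... | no  _ = (u , v) ∷ []

edgesB* : (n : ℕ) → List (Word n × Word n)
edgesB* n = concatMap (λ u → loopless u (basA u) ++ loopless u (basB u)) (allWords n)

tutteB* : (n : ℕ) → ℤ → ℤ → ℤ
tutteB* n = Graph.tutte (_≟W_ {n}) (allWords n) (edgesB* n)

sumPow : ℕ → ℤ → ℤ
sumPow zero    x = 0ℤ
sumPow (suc k) x = sumPow k x + x ^ suc k

geo : ℕ → ℤ → ℤ → ℤ
geo m x y = y + sumPow (m ∸ 1) x

prodFrom1 : ℕ → (ℕ → ℤ) → ℤ
prodFrom1 zero    f = 1ℤ
prodFrom1 (suc K) f = prodFrom1 K f * f (suc K)

basProd : ℕ → ℕ → ℤ → ℤ → ℤ
basProd n K x y =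
  prodFrom1 K (λ i → geo (2 ℕ.^ i) x y ^ (3 ℕ.* 2 ℕ.^ (n ∸ 2 ℕ.* i ∸ 1)))

-- The loopless Schreier graph B*ₙ is a cactus: its edges split into the nontrivial orbits of the generators a
-- and b, each orbit is a cycle, and the graph is connected with cyclomatic number equal to the number of these
-- cycles. In a cactus the nullity of an edge set is the number of cycles it contains entirely, so the Tutte sum
-- factors into the Tutte polynomials y + x + ⋯ + x^(ℓ-1) of the cycles, ℓ being the cycle lengths. The lengths
-- follow from the self-similarity of the group: passing from level m to level m + 2 doubles every cycle and
-- adds 2-cycles coming from the fixed points of a, which unfolds into the stated product.

module Submission where

module Counting where

  open import Data.Bool using (if_then_else_)
  open import Data.Empty using (⊥-elim)
  open import Data.Nat using (ℕ; suc; _+_; _≤_; _∸_; z≤n; s≤s)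
  open import Data.Nat.Properties using (+-suc; +-assoc; ≤-trans; ≤-antisym; n≤1+n; <⇒≢; +-commutativeSemigroup)
  open import Algebra.Properties.CommutativeSemigroup +-commutativeSemigroup using (interchange)
  open import Data.List using (List; []; _∷_; _++_; map; length; filter; concatMap)
  open import Data.List.Properties using (filter-accept; filter-reject; filter-none; filter-++; length-++)
  open import Data.List.Membership.Propositional using (_∈_; find)
  open import Data.List.Membership.Propositional.Properties using (∈-filter⁺; ∈-filter⁻; ∈-concatMap⁻)
  open import Data.List.Relation.Unary.All as All using (All)
  import Data.List.Relation.Unary.All.Properties as AllProperties
  open import Data.List.Relation.Unary.Any using (here; there)
  open import Data.List.Relation.Unary.Unique.Propositional using (Unique; []; _∷_)
  import Data.List.Relation.Unary.Unique.Propositional.Properties as Unique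
  open import Data.Product using (_×_; _,_; proj₁; proj₂; ∃)
  open import Data.Sum as Sum using (_⊎_; inj₁; inj₂)
  open import Data.List.Relation.Ternary.Interleaving.Propositional using (Interleaving; consˡ; consʳ)
  open import Data.List.Relation.Ternary.Interleaving using ([])
  open import Level using (0ℓ)
  open import Relation.Nullary using (yes; no; ¬_; ¬?)
  open import Relation.Nullary.Decidable using (⌊_⌋)
  open import Relation.Unary using (Pred; Decidable)
  open import Relation.Binary.PropositionalEquality
  open import Relation.Binary using (DecidableEquality)

  count : {A : Set} {P : Pred A 0ℓ} → Decidable P → List A → ℕ
  count P? xs = length (filter P? xs)

  module _ {A : Set} {P : Pred A 0ℓ} (P? : Decidable P) where

    count-accept : ∀ {x} xs → P x → count P? (x ∷ xs) ≡ suc (count P? xs)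
    count-accept xs px = cong length (filter-accept P? px)

    count-reject : ∀ {x} xs → ¬ P x → count P? (x ∷ xs) ≡ count P? xs
    count-reject xs ¬px = cong length (filter-reject P? ¬px)

    count-++ : ∀ xs ys → count P? (xs ++ ys) ≡ count P? xs + count P? ys
    count-++ xs ys = trans (cong length (filter-++ P? xs ys)) (length-++ (filter P? xs))

    count-none : ∀ xs → (∀ x → x ∈ xs → ¬ P x) → count P? xs ≡ 0
    count-none xs h = cong length (filter-none P? (All.tabulate (h _)))

    count-pos : ∀ {x} xs → x ∈ xs → P x → 1 ≤ count P? xs
    count-pos xs x∈ px with filter P? xs | ∈-filter⁺ P? x∈ px
    ... | _ ∷ _ | _ = s≤s z≤n

    count≡0⇒¬ : ∀ {x} xs → count P? xs ≡ 0 → x ∈ xs → ¬ P x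
    count≡0⇒¬ xs eq x∈ px = <⇒≢ (count-pos xs x∈ px) (sym eq)

    count≢0⇒∃ : ∀ xs → ¬ count P? xs ≡ 0 → ∃ λ x → x ∈ xs × P x
    count≢0⇒∃ xs nz with filter P? xs in eq
    ... | []    = ⊥-elim (nz refl)
    ... | x ∷ _ = x , ∈-filter⁻ P? (subst (x ∈_) (sym eq) (here refl))

    count≡1 : ∀ {c} xs → Unique xs → c ∈ xs → P c → (∀ x → P x → x ≡ c) → count P? xs ≡ 1
    count≡1 (x ∷ xs) (x≢ ∷ _) (here refl) pc h =
      trans (count-accept xs pc)
            (cong suc (count-none xs (λ w w∈ pw → All.lookup x≢ w∈ (sym (h w pw)))))
    count≡1 (x ∷ xs) (x≢ ∷ u) (there c∈) pc h =
      trans (count-reject xs (λ px → All.lookup x≢ c∈ (h x px))) (count≡1 xs u c∈ pc h)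

    count+count-∁ : ∀ xs → count P? xs + count (λ x → ¬? (P? x)) xs ≡ length xs
    count+count-∁ [] = refl
    count+count-∁ (x ∷ xs) with P? x
    ... | yes _ = cong suc (count+count-∁ xs)
    ... | no _  = trans (+-suc _ _) (cong suc (count+count-∁ xs))

  module _ {A : Set} {P Q : Pred A 0ℓ} (P? : Decidable P) (Q? : Decidable Q) where

    count-mono : ∀ xs → (∀ x → x ∈ xs → P x → Q x) → count P? xs ≤ count Q? xs
    count-mono [] h = z≤n
    count-mono (x ∷ xs) h with P? x | Q? x
    ... | yes _ | yes _ = s≤s (count-mono xs (λ y y∈ → h y (there y∈)))
    ... | yes p | no ¬q = ⊥-elim (¬q (h x (here refl) p))
    ... | no _  | yes _ = ≤-trans (count-mono xs (λ y y∈ → h y (there y∈))) (n≤1+n _)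
    ... | no _  | no _  = count-mono xs (λ y y∈ → h y (there y∈))

    count-mono-except : ∀ {i} xs → Unique xs → (∀ x → x ∈ xs → ¬ x ≡ i → P x → Q x) →
                        count P? xs ≤ suc (count Q? xs)
    count-mono-except [] _ h = z≤n
    count-mono-except {i} (x ∷ xs) (x≢ ∷ u) h with P? x | Q? x
    ... | yes _ | yes _ = s≤s (count-mono-except xs u (λ y y∈ → h y (there y∈)))
    ... | no _  | yes _ = ≤-trans (count-mono-except xs u (λ y y∈ → h y (there y∈))) (n≤1+n _)
    ... | no _  | no _  = count-mono-except xs u (λ y y∈ → h y (there y∈))
    ... | yes p | no ¬q = s≤s (count-mono xs (λ y y∈ py → h y (there y∈) (y≢i y y∈) py))
      where
      y≢i : ∀ y → y ∈ xs → ¬ y ≡ i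
      y≢i y y∈ refl = ¬q (h x (here refl) (λ x≡i → All.lookup x≢ y∈ x≡i) p)

  module _ {A : Set} {P Q : Pred A 0ℓ} (P? : Decidable P) (Q? : Decidable Q) where

    count-cong : ∀ xs → (∀ x → x ∈ xs → P x → Q x) → (∀ x → x ∈ xs → Q x → P x) →
                 count P? xs ≡ count Q? xs
    count-cong xs to from = ≤-antisym (count-mono P? Q? xs to) (count-mono Q? P? xs from)

    count-remove : ∀ {c} xs → Unique xs → c ∈ xs → P c → ¬ Q c →
                   (∀ x → x ∈ xs → ¬ x ≡ c → (P x → Q x) × (Q x → P x)) →
                   count P? xs ≡ suc (count Q? xs)
    count-remove (x ∷ xs) (x≢ ∷ _) (here refl) pc ¬qc h =
      trans (count-accept P? xs pc)
        (cong suc (trans (count-cong xs (λ w w∈ → proj₁ (h w (there w∈) (w≢x w∈)))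
                                        (λ w w∈ → proj₂ (h w (there w∈) (w≢x w∈))))
                         (sym (count-reject Q? xs ¬qc))))
      where
      w≢x : ∀ {w} → w ∈ xs → ¬ w ≡ x
      w≢x w∈ w≡x = All.lookup x≢ w∈ (sym w≡x)
    count-remove (x ∷ xs) (x≢ ∷ u) (there c∈) pc ¬qc h
      with P? x | Q? x | h x (here refl) (All.lookup x≢ c∈)
    ... | yes _ | yes _ | _      = cong suc (count-remove xs u c∈ pc ¬qc (λ w w∈ → h w (there w∈)))
    ... | no _  | no _  | _      = count-remove xs u c∈ pc ¬qc (λ w w∈ → h w (there w∈))
    ... | yes p | no ¬q | pq , _ = ⊥-elim (¬q (pq p))
    ... | no ¬p | yes q | _ , qp = ⊥-elim (¬p (qp q))

  module _ {A B : Set} {P : Pred B 0ℓ} (P? : Decidable P) (f : A → B) where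

    count-map : ∀ xs → count P? (map f xs) ≡ count (λ x → P? (f x)) xs
    count-map [] = refl
    count-map (x ∷ xs) with P? (f x)
    ... | yes _ = cong suc (count-map xs)
    ... | no _  = count-map xs

  sumOver : {I : Set} → List I → (I → ℕ) → ℕ
  sumOver []       h = 0
  sumOver (j ∷ js) h = h j + sumOver js h

  module _ {I : Set} where

    sumOver-cong : ∀ (js : List I) {h h′ : I → ℕ} → (∀ j → j ∈ js → h j ≡ h′ j) →
                   sumOver js h ≡ sumOver js h′
    sumOver-cong [] e = refl
    sumOver-cong (j ∷ js) e = cong₂ _+_ (e j (here refl)) (sumOver-cong js (λ k k∈ → e k (there k∈)))

    sumOver-++ : ∀ (xs ys : List I) h → sumOver (xs ++ ys) h ≡ sumOver xs h + sumOver ys h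
    sumOver-++ [] ys h = refl
    sumOver-++ (x ∷ xs) ys h = trans (cong (h x +_) (sumOver-++ xs ys h)) (sym (+-assoc (h x) _ _))

    sumOver-+ : ∀ (js : List I) f g → sumOver js (λ j → f j + g j) ≡ sumOver js f + sumOver js g
    sumOver-+ [] f g = refl
    sumOver-+ (j ∷ js) f g =
      trans (cong ((f j + g j) +_) (sumOver-+ js f g)) (interchange (f j) (g j) (sumOver js f) (sumOver js g))

    sumOver-const1 : ∀ (js : List I) → sumOver js (λ _ → 1) ≡ length js
    sumOver-const1 [] = refl
    sumOver-const1 (j ∷ js) = cong suc (sumOver-const1 js)

    sumOver-const0 : ∀ (js : List I) → sumOver js (λ _ → 0) ≡ 0
    sumOver-const0 [] = refl
    sumOver-const0 (j ∷ js) = sumOver-const0 js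

    sumOver-indicator : {P : Pred I 0ℓ} (P? : Decidable P) (js : List I) →
                        sumOver js (λ j → if ⌊ P? j ⌋ then 1 else 0) ≡ count P? js
    sumOver-indicator P? [] = refl
    sumOver-indicator P? (j ∷ js) with P? j
    ... | yes _ = cong suc (sumOver-indicator P? js)
    ... | no _  = sumOver-indicator P? js

    sumOver-∸1 : ∀ (js : List I) f → (∀ j → j ∈ js → 1 ≤ f j) →
                 sumOver js (λ j → f j ∸ 1) + length js ≡ sumOver js f
    sumOver-∸1 [] f h = refl
    sumOver-∸1 (j ∷ js) f h with f j | h j (here refl)
    ... | suc m | _ = trans (+-suc (m + sumOver js (λ j → f j ∸ 1)) (length js))
                        (cong suc (trans (+-assoc m _ _)
                                         (cong (m +_) (sumOver-∸1 js f (λ k k∈ → h k (there k∈))))))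

    sumOver-bump : ∀ {i} (js : List I) → Unique js → i ∈ js → (f g : I → ℕ) →
                   (∀ j → j ∈ js → ¬ j ≡ i → f j ≡ g j) → f i ≡ suc (g i) →
                   sumOver js f ≡ suc (sumOver js g)
    sumOver-bump (j ∷ js) (j≢ ∷ _) (here refl) f g h hi =
      cong₂ _+_ hi (sumOver-cong js (λ k k∈ → h k (there k∈) (λ k≡j → All.lookup j≢ k∈ (sym k≡j))))
    sumOver-bump (j ∷ js) (j≢ ∷ u) (there i∈) f g h hi =
      trans (cong₂ _+_ (h j (here refl) (All.lookup j≢ i∈))
                       (sumOver-bump js u i∈ f g (λ k k∈ → h k (there k∈)) hi))
            (+-suc (g j) _)

  module _ {I J : Set} where

    sumOver-map : ∀ (g : J → I) xs (f : I → ℕ) → sumOver (map g xs) f ≡ sumOver xs (λ x → f (g x))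
    sumOver-map g [] f = refl
    sumOver-map g (x ∷ xs) f = cong (f (g x) +_) (sumOver-map g xs f)

  module _ {A B : Set} {P : Pred A 0ℓ} (P? : Decidable P) where

    count-concatMap : ∀ (f : B → List A) xs → count P? (concatMap f xs) ≡ sumOver xs (λ x → count P? (f x))
    count-concatMap f [] = refl
    count-concatMap f (x ∷ xs) =
      trans (count-++ P? (f x) (concatMap f xs)) (cong (count P? (f x) +_) (count-concatMap f xs))

  module _ {A : Set} where

    interleaving-∈⁻ : ∀ {xs ys zs : List A} {z} → Interleaving xs ys zs → z ∈ zs → z ∈ xs ⊎ z ∈ ys
    interleaving-∈⁻ (consˡ sp) (here refl) = inj₁ (here refl)
    interleaving-∈⁻ (consʳ sp) (here refl) = inj₂ (here refl)
    interleaving-∈⁻ (consˡ sp) (there z∈) = Sum.map₁ there (interleaving-∈⁻ sp z∈)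
    interleaving-∈⁻ (consʳ sp) (there z∈) = Sum.map₂ there (interleaving-∈⁻ sp z∈)

    interleaving-∈ˡ : ∀ {xs ys zs : List A} {x} → Interleaving xs ys zs → x ∈ xs → x ∈ zs
    interleaving-∈ˡ (consˡ sp) (here refl) = here refl
    interleaving-∈ˡ (consˡ sp) (there x∈) = there (interleaving-∈ˡ sp x∈)
    interleaving-∈ˡ (consʳ sp) x∈          = there (interleaving-∈ˡ sp x∈)

    interleaving-∈ʳ : ∀ {xs ys zs : List A} {y} → Interleaving xs ys zs → y ∈ ys → y ∈ zs
    interleaving-∈ʳ (consʳ sp) (here refl) = here refl
    interleaving-∈ʳ (consʳ sp) (there y∈) = there (interleaving-∈ʳ sp y∈)
    interleaving-∈ʳ (consˡ sp) y∈          = there (interleaving-∈ʳ sp y∈)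

    interleaving-disjoint : ∀ {xs ys zs : List A} {x} → Interleaving xs ys zs → Unique zs → x ∈ xs → ¬ x ∈ ys
    interleaving-disjoint (consˡ sp) (z≢ ∷ _) (here refl) x∈ys = All.lookup z≢ (interleaving-∈ʳ sp x∈ys) refl
    interleaving-disjoint (consˡ sp) (_ ∷ u)  (there x∈) x∈ys  = interleaving-disjoint sp u x∈ x∈ys
    interleaving-disjoint (consʳ sp) (z≢ ∷ _) x∈xs (here refl) = All.lookup z≢ (interleaving-∈ˡ sp x∈xs) refl
    interleaving-disjoint (consʳ sp) (_ ∷ u)  x∈xs (there x∈)  = interleaving-disjoint sp u x∈xs x∈

    count-interleaving : ∀ {P : Pred A 0ℓ} (P? : Decidable P) {xs ys zs} → Interleaving xs ys zs →
                         count P? xs + count P? ys ≡ count P? zs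
    count-interleaving P? [] = refl
    count-interleaving P? {a ∷ _} (consˡ sp) with P? a
    ... | yes _ = cong suc (count-interleaving P? sp)
    ... | no _  = count-interleaving P? sp
    count-interleaving P? {xs} {b ∷ _} (consʳ sp) with P? b
    ... | yes _ = trans (+-suc (count P? xs) _) (cong suc (count-interleaving P? sp))
    ... | no _  = count-interleaving P? sp

  sumOver-fibres : {A I : Set} (_≟_ : DecidableEquality I) (f : A → I) (ys : List I) → Unique ys →
                   ∀ xs → (∀ x → x ∈ xs → f x ∈ ys) →
                   sumOver ys (λ y → count (λ x → f x ≟ y) xs) ≡ length xs
  sumOver-fibres _≟_ f ys ys-unique []       _   = sumOver-const0 ys
  sumOver-fibres _≟_ f ys ys-unique (x ∷ xs) f∈ =
    trans (sumOver-bump ys ys-unique (f∈ x (here refl)) _ _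
                        (λ y _ y≢fx → count-reject (λ x → f x ≟ y) xs (λ fx≡y → y≢fx (sym fx≡y)))
                        (count-accept (λ x′ → f x′ ≟ f x) xs refl))
          (cong suc (sumOver-fibres _≟_ f ys ys-unique xs (λ x′ x′∈ → f∈ x′ (there x′∈))))

  unique-concatMap : {A B : Set} (f : A → List B) {xs : List A} → Unique xs → (∀ x → Unique (f x)) →
                     (∀ x y {z} → z ∈ f x → z ∈ f y → x ≡ y) → Unique (concatMap f xs)
  unique-concatMap f []                 _  _    = []
  unique-concatMap f {x ∷ xs} (x≢ ∷ u) uf same = Unique.++⁺ (uf x) (unique-concatMap f u uf same) disjoint
    where
    disjoint : ∀ {z} → ¬ (z ∈ f x × z ∈ concatMap f xs)
    disjoint (z∈fx , z∈rest) with find (∈-concatMap⁻ f z∈rest)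
    ... | y , y∈ , z∈fy = All.lookup x≢ y∈ (same x y z∈fx z∈fy)

  unique-++⁻ˡ : {A : Set} (xs : List A) {ys : List A} → Unique (xs ++ ys) → Unique xs
  unique-++⁻ˡ []       _          = []
  unique-++⁻ˡ (x ∷ xs) (x≢ ∷ u) = AllProperties.++⁻ˡ xs x≢ ∷ unique-++⁻ˡ xs u

module Products where

  open import Data.Integer using (ℤ; _+_; _*_; _^_; 1ℤ)
  open import Data.Integer.Properties
    using (*-distribˡ-+; *-distribʳ-+; *-identityˡ; *-assoc; ^-distribˡ-+-*; *-commutativeSemigroup)
  open import Algebra.Properties.CommutativeSemigroup *-commutativeSemigroup using (interchange)
  open import Data.List using (List; []; _∷_; _++_; map; length)
  open import Data.List.Membership.Propositional using (_∈_)
  open import Data.List.Relation.Unary.All as All using (All)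
  open import Data.List.Relation.Unary.Any using (here; there)
  open import Data.List.Relation.Unary.Unique.Propositional using (Unique; _∷_)
  open import Relation.Nullary using (¬_)
  open import Relation.Binary.PropositionalEquality
  open Counting using (sumOver)

  prodOver : {I : Set} → List I → (I → ℤ) → ℤ
  prodOver []       h = 1ℤ
  prodOver (j ∷ js) h = h j * prodOver js h

  module _ {I : Set} where

    prodOver-cong : ∀ (js : List I) {h h′ : I → ℤ} → (∀ j → j ∈ js → h j ≡ h′ j) →
                    prodOver js h ≡ prodOver js h′
    prodOver-cong [] e = refl
    prodOver-cong (j ∷ js) e = cong₂ _*_ (e j (here refl)) (prodOver-cong js (λ k k∈ → e k (there k∈)))

    prodOver-++ : ∀ (xs ys : List I) h → prodOver (xs ++ ys) h ≡ prodOver xs h * prodOver ys h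
    prodOver-++ [] ys h = sym (*-identityˡ _)
    prodOver-++ (x ∷ xs) ys h = trans (cong (h x *_) (prodOver-++ xs ys h)) (sym (*-assoc (h x) _ _))

    prodOver-* : ∀ (js : List I) f g → prodOver js (λ j → f j * g j) ≡ prodOver js f * prodOver js g
    prodOver-* [] f g = refl
    prodOver-* (j ∷ js) f g =
      trans (cong (f j * g j *_) (prodOver-* js f g)) (interchange (f j) (g j) (prodOver js f) (prodOver js g))

    prodOver-^ : ∀ (js : List I) t f → prodOver js (λ j → t ^ f j) ≡ t ^ sumOver js f
    prodOver-^ [] t f = refl
    prodOver-^ (j ∷ js) t f = trans (cong (t ^ f j *_) (prodOver-^ js t f)) (sym (^-distribˡ-+-* t (f j) (sumOver js f)))

    prodOver-const : ∀ (xs : List I) c → prodOver xs (λ _ → c) ≡ c ^ length xs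
    prodOver-const [] c = refl
    prodOver-const (x ∷ xs) c = cong (c *_) (prodOver-const xs c)

    prodOver-+-at : ∀ {i} (js : List I) → Unique js → i ∈ js → (f g h : I → ℤ) →
                    (∀ j → j ∈ js → ¬ j ≡ i → f j ≡ h j) →
                    (∀ j → j ∈ js → ¬ j ≡ i → g j ≡ h j) →
                    f i + g i ≡ h i → prodOver js f + prodOver js g ≡ prodOver js h
    prodOver-+-at {i} (j ∷ js) (j≢ ∷ _) (here refl) f g h fh gh hi = begin
      f i * prodOver js f + g i * prodOver js g
        ≡⟨ cong₂ (λ p q → f i * p + g i * q) (prodOver-cong js (λ k k∈ → fh k (there k∈) (k≢i k∈)))
                                            (prodOver-cong js (λ k k∈ → gh k (there k∈) (k≢i k∈))) ⟩
      f i * prodOver js h + g i * prodOver js h  ≡⟨ sym (*-distribʳ-+ (prodOver js h) (f i) (g i)) ⟩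
      (f i + g i) * prodOver js h                ≡⟨ cong (_* prodOver js h) hi ⟩
      h i * prodOver js h                        ∎
      where
      open ≡-Reasoning
      k≢i : ∀ {k} → k ∈ js → ¬ k ≡ i
      k≢i k∈ k≡i = All.lookup j≢ k∈ (sym k≡i)
    prodOver-+-at (j ∷ js) (j≢ ∷ u) (there i∈) f g h fh gh hi = begin
      f j * prodOver js f + g j * prodOver js g
        ≡⟨ cong₂ (λ p q → p * prodOver js f + q * prodOver js g) (fh j (here refl) j≢i)
                                                                  (gh j (here refl) j≢i) ⟩
      h j * prodOver js f + h j * prodOver js g  ≡⟨ sym (*-distribˡ-+ (h j) (prodOver js f) (prodOver js g)) ⟩
      h j * (prodOver js f + prodOver js g)
        ≡⟨ cong (h j *_) (prodOver-+-at js u i∈ f g h (λ k k∈ → fh k (there k∈))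
                                                      (λ k k∈ → gh k (there k∈)) hi) ⟩
      h j * prodOver js h                        ∎
      where
      open ≡-Reasoning
      j≢i = All.lookup j≢ i∈

  module _ {I J : Set} where

    prodOver-map : ∀ (g : J → I) xs (h : I → ℤ) → prodOver (map g xs) h ≡ prodOver xs (λ x → h (g x))
    prodOver-map g [] h = refl
    prodOver-map g (x ∷ xs) h = cong (h (g x) *_) (prodOver-map g xs h)

module CyclePolynomial where

  open import Data.Bool using (if_then_else_)
  open import Data.Empty using (⊥-elim)
  open import Data.Integer using (ℤ; _+_; _*_; _-_; _^_; 0ℤ; 1ℤ)
  open import Data.Integer.Properties using (*-distribˡ-+; *-identityʳ)
  open import Data.Integer.Tactic.RingSolver using (solve-∀)
  open import Data.Nat as ℕ using (ℕ; zero; suc; _≤_; _∸_; z≤n; s≤s)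
  open import Data.Nat.Properties
    using (m≤n⇒m≤1+n; +-∸-assoc; 1+n≰n; m∸n+n≡m; ≤-pred; ≤∧≢⇒<; +-identityʳ)
  open import Relation.Nullary using (yes; no; ¬_)
  open import Relation.Nullary.Decidable using (⌊_⌋)
  open import Relation.Binary.PropositionalEquality
  open import Defs using (geo; sumPow)

  -- binomSum m g = Σₖ (m choose k) g k, the sum of g |S| over all subsets S of an m-element set.
  binomSum : ℕ → (ℕ → ℤ) → ℤ
  binomSum zero    g = g 0
  binomSum (suc m) g = binomSum m g + binomSum m (λ k → g (suc k))

  binomSum-cong : ∀ m {g g′ : ℕ → ℤ} → (∀ k → k ≤ m → g k ≡ g′ k) →
                  binomSum m g ≡ binomSum m g′
  binomSum-cong zero e = e 0 z≤n
  binomSum-cong (suc m) e =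
    cong₂ _+_ (binomSum-cong m (λ k k≤m → e k (m≤n⇒m≤1+n k≤m)))
              (binomSum-cong m (λ k k≤m → e (suc k) (s≤s k≤m)))

  binomSum-scale : ∀ m t (g : ℕ → ℤ) → binomSum m (λ k → t * g k) ≡ t * binomSum m g
  binomSum-scale zero t g = refl
  binomSum-scale (suc m) t g =
    trans (cong₂ _+_ (binomSum-scale m t g) (binomSum-scale m t (λ k → g (suc k)))) (sym (*-distribˡ-+ t _ _))

  binomial-theorem : ∀ m t → binomSum m (λ k → t ^ (m ∸ k)) ≡ (t + 1ℤ) ^ m
  binomial-theorem zero t = refl
  binomial-theorem (suc m) t = begin
    binomSum m (λ k → t ^ (suc m ∸ k)) + B
      ≡⟨ cong (_+ B) (binomSum-cong m (λ k k≤m → cong (t ^_) (+-∸-assoc 1 k≤m))) ⟩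
    binomSum m (λ k → t * t ^ (m ∸ k)) + B  ≡⟨ cong (_+ B) (binomSum-scale m t (λ k → t ^ (m ∸ k))) ⟩
    t * B + B                               ≡⟨ cong (λ z → t * z + z) (binomial-theorem m t) ⟩
    t * (t + 1ℤ) ^ m + (t + 1ℤ) ^ m         ≡⟨ factor t ((t + 1ℤ) ^ m) ⟩
    (t + 1ℤ) * (t + 1ℤ) ^ m                 ∎
    where
    open ≡-Reasoning
    B = binomSum m (λ k → t ^ (m ∸ k))
    factor : ∀ t p → t * p + p ≡ (t + 1ℤ) * p
    factor = solve-∀

  -- The Tutte summand (x-1)^(r(C)-r(A)) (y-1)^(|A|-r(A)) of a set A of c edges of an m-cycle C.
  cycleWeight : ℤ → ℤ → ℕ → ℕ → ℤ
  cycleWeight x y m c = if ⌊ c ℕ.≟ m ⌋ then y - 1ℤ else (x - 1ℤ) ^ (m ∸ suc c)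

  cycleWeight-full : ∀ x y m c → c ≡ m → cycleWeight x y m c ≡ y - 1ℤ
  cycleWeight-full x y m c c≡m with c ℕ.≟ m
  ... | yes _   = refl
  ... | no c≢m = ⊥-elim (c≢m c≡m)

  cycleWeight-partial : ∀ x y m c → ¬ c ≡ m → cycleWeight x y m c ≡ (x - 1ℤ) ^ (m ∸ suc c)
  cycleWeight-partial x y m c c≢m with c ℕ.≟ m
  ... | yes c≡m = ⊥-elim (c≢m c≡m)
  ... | no _    = refl

  cycleExponent : ℕ → ℕ → ℕ
  cycleExponent m c = if ⌊ c ℕ.≟ m ⌋ then 0 else m ∸ suc c

  isFull : ℕ → ℕ → ℕ
  isFull m c = if ⌊ c ℕ.≟ m ⌋ then 1 else 0

  cycleWeight-powers : ∀ x y m c → cycleWeight x y m c ≡ (x - 1ℤ) ^ cycleExponent m c * (y - 1ℤ) ^ isFull m c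
  cycleWeight-powers x y m c with c ℕ.≟ m
  ... | yes _ = unit-powers (y - 1ℤ)
    where
    unit-powers : ∀ t → t ≡ 1ℤ * (t * 1ℤ)
    unit-powers = solve-∀
  ... | no _  = sym (*-identityʳ _)

  cycleExponent+count : ∀ m c → c ≤ m → 1 ≤ m → cycleExponent m c ℕ.+ c ≡ (m ∸ 1) ℕ.+ isFull m c
  cycleExponent+count m c c≤m 1≤m with c ℕ.≟ m
  ... | yes refl = sym (m∸n+n≡m 1≤m)
  cycleExponent+count (suc m) c c≤1+m _ | no c≢1+m =
    trans (m∸n+n≡m (≤-pred (≤∧≢⇒< c≤1+m c≢1+m))) (sym (+-identityʳ m))

  -- Deletion–contraction on one edge of an (m+1)-cycle: deleting it leaves a path of m edges, with Tutte
  -- polynomial xᵐ, and contracting it leaves an m-cycle.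
  binomSum-cycleWeight-suc : ∀ x y m →
    binomSum (suc m) (cycleWeight x y (suc m)) ≡ x ^ m + binomSum m (cycleWeight x y m)
  binomSum-cycleWeight-suc x y m = cong₂ _+_ avoiding containing
    where
    avoiding : binomSum m (cycleWeight x y (suc m)) ≡ x ^ m
    avoiding = trans (binomSum-cong m partial)
                     (trans (binomial-theorem m (x - 1ℤ)) (cong (_^ m) (cancel x)))
      where
      cancel : ∀ x → x - 1ℤ + 1ℤ ≡ x
      cancel = solve-∀
      partial : ∀ k → k ≤ m → cycleWeight x y (suc m) k ≡ (x - 1ℤ) ^ (m ∸ k)
      partial k k≤m = cycleWeight-partial x y (suc m) k (λ { refl → 1+n≰n k≤m })
    containing : binomSum m (λ k → cycleWeight x y (suc m) (suc k)) ≡ binomSum m (cycleWeight x y m)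
    containing = binomSum-cong m shift
      where
      shift : ∀ k → k ≤ m → cycleWeight x y (suc m) (suc k) ≡ cycleWeight x y m k
      shift k _ with k ℕ.≟ m
      ... | yes refl = cycleWeight-full x y (suc m) (suc m) refl
      ... | no k≢m   = cycleWeight-partial x y (suc m) (suc k) (λ e → k≢m (cong ℕ.pred e))

  binomSum-cycleWeight : ∀ x y m → binomSum (suc m) (cycleWeight x y (suc m)) ≡ geo (suc m) x y
  binomSum-cycleWeight x y zero = loop x y
    where
    loop : ∀ x y → 1ℤ + (y - 1ℤ) ≡ y + 0ℤ
    loop = solve-∀
  binomSum-cycleWeight x y (suc m) =
    trans (binomSum-cycleWeight-suc x y (suc m))
          (trans (cong (x ^ suc m +_) (binomSum-cycleWeight x y m)) (rearrange (x ^ suc m) y (sumPow m x)))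
    where
    rearrange : ∀ p y s → p + (y + s) ≡ y + (s + p)
    rearrange = solve-∀

module Cactus where

  open import Data.Bool using (Bool; true; false; if_then_else_)
  open import Data.Empty using (⊥-elim)
  open import Data.Nat as ℕ using (ℕ; suc; _+_; _≤_; _∸_; z≤n; s≤s)
  import Data.Nat.Properties as ℕ
  open import Data.List using (List; []; _∷_; _++_; [_]; map; length; foldl)
  open import Data.List.Properties using (foldl-++; ++-assoc; ++-identityʳ; map-++; map-∘; map-cong; map-cong-local)
  open import Data.List.Relation.Unary.All as All using (All; []; _∷_; all?)
  open import Data.List.Membership.Propositional.Properties using (∈-++⁻; ∈-++⁺ˡ; ∈-++⁺ʳ; ∈-map⁻)
  open import Data.List.Relation.Ternary.Interleaving.Propositional using (Interleaving; consˡ; consʳ)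
  open import Data.List.Relation.Ternary.Interleaving using ([])
  open import Data.List.Relation.Ternary.Interleaving.Properties using (interleave-length)
  open import Data.Nat.Tactic.RingSolver using (solve-∀)
  open import Data.Integer as ℤ using (ℤ; _-_; _^_; 1ℤ)
  import Data.Integer.Properties as ℤ
  open import Data.List.Membership.Propositional using (_∈_)
  open import Data.List.Relation.Unary.Any using (here; there)
  open import Data.List.Relation.Unary.Unique.Propositional using (Unique)
  open import Data.Product using (_×_; _,_; proj₁; proj₂; ∃)
  open import Data.Product.Properties using () renaming (≡-dec to ×-≡-dec)
  open import Data.Sum using (inj₁; inj₂; [_,_]′)
  open import Relation.Nullary using (Dec; yes; no; ¬_; ¬?)
  open import Relation.Nullary.Decidable using (⌊_⌋; _×-dec_; _→-dec_)
  open import Relation.Binary using (DecidableEquality)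
  open import Relation.Binary.PropositionalEquality hiding ([_])
  open import Defs using (module Graph; geo)
  open Counting
  open Products
  open CyclePolynomial

  data Walk {V : Set} (Q : V × V → Set) : V → V → Set where
    []  : ∀ {u} → Walk Q u u
    fwd : ∀ {u w v} → Q (u , w) → Walk Q w v → Walk Q u v
    bwd : ∀ {u w v} → Q (w , u) → Walk Q w v → Walk Q u v

  module _ {V : Set} {Q : V × V → Set} where

    walk-++ : ∀ {u w v} → Walk Q u w → Walk Q w v → Walk Q u v
    walk-++ []        r = r
    walk-++ (fwd q p) r = fwd q (walk-++ p r)
    walk-++ (bwd q p) r = bwd q (walk-++ p r)

    walk-reverse : ∀ {u v} → Walk Q u v → Walk Q v u
    walk-reverse []        = []
    walk-reverse (fwd q p) = walk-++ (walk-reverse p) (bwd q [])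
    walk-reverse (bwd q p) = walk-++ (walk-reverse p) (fwd q [])

    walk-map : ∀ {Q′ : V × V → Set} → (∀ e → Q e → Q′ e) → ∀ {u v} → Walk Q u v → Walk Q′ u v
    walk-map h []        = []
    walk-map h (fwd q p) = fwd (h _ q) (walk-map h p)
    walk-map h (bwd q p) = bwd (h _ q) (walk-map h p)

  module _ {V V′ : Set} {Q : V × V → Set} {Q′ : V′ × V′ → Set} where

    walk-bind : (g : V → V′) →
                (∀ p q → Q (p , q) → Walk Q′ (g p) (g q)) → ∀ {u v} → Walk Q u v → Walk Q′ (g u) (g v)
    walk-bind g h []        = []
    walk-bind g h (fwd q p) = walk-++ (h _ _ q) (walk-bind g h p)
    walk-bind g h (bwd q p) = walk-++ (walk-reverse (h _ _ q)) (walk-bind g h p)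

  module Components {V : Set} (_≟_ : DecidableEquality V) where

    open Graph _≟_ public

    Edge : Set
    Edge = V × V

    Idempotent : (V → V) → Set
    Idempotent f = ∀ w → f (f w) ≡ f w

    private
      if-same : ∀ {A : Set} (b : Bool) (x : A) → (if b then x else x) ≡ x
      if-same true  x = refl
      if-same false x = refl

    merge-idempotent : ∀ f e → Idempotent f → Idempotent (merge f e)
    merge-idempotent f (u , v) idem w with f w ≟ f v
    ... | yes _ rewrite idem u = if-same ⌊ f u ≟ f v ⌋ (f u)
    ... | no fw≢fv rewrite idem w with f w ≟ f v
    ...   | yes fw≡fv = ⊥-elim (fw≢fv fw≡fv)
    ...   | no _      = refl

    foldl-merge-idempotent : ∀ f P → Idempotent f → Idempotent (foldl merge f P)
    foldl-merge-idempotent f []      idem = idem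
    foldl-merge-idempotent f (e ∷ P) idem = foldl-merge-idempotent (merge f e) P (merge-idempotent f e idem)

    label-idempotent : ∀ P → Idempotent (label P)
    label-idempotent P = foldl-merge-idempotent (λ w → w) P (λ _ → refl)

    foldl-merge-resp : ∀ f P {a b} → f a ≡ f b → foldl merge f P a ≡ foldl merge f P b
    foldl-merge-resp f []            fa≡fb = fa≡fb
    foldl-merge-resp f ((u , v) ∷ P) fa≡fb =
      foldl-merge-resp (merge f (u , v)) P (cong (λ t → if ⌊ t ≟ f v ⌋ then f u else t) fa≡fb)

    merge-joins : ∀ f u v → merge f (u , v) u ≡ merge f (u , v) v
    merge-joins f u v with f v ≟ f v
    ... | yes _   = if-same ⌊ f u ≟ f v ⌋ (f u)
    ... | no fv≢fv = ⊥-elim (fv≢fv refl)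

    foldl-merge-joins : ∀ f P {e} → e ∈ P → foldl merge f P (proj₁ e) ≡ foldl merge f P (proj₂ e)
    foldl-merge-joins f (e ∷ P) (here refl) = foldl-merge-resp (merge f e) P (merge-joins f (proj₁ e) (proj₂ e))
    foldl-merge-joins f (e ∷ P) (there e∈)  = foldl-merge-joins (merge f e) P e∈

    walk⇒same-label : ∀ {Q} P → (∀ e → Q e → e ∈ P) → ∀ {u v} → Walk Q u v → label P u ≡ label P v
    walk⇒same-label P sub []        = refl
    walk⇒same-label P sub (fwd q p) = trans (foldl-merge-joins (λ w → w) P (sub _ q)) (walk⇒same-label P sub p)
    walk⇒same-label P sub (bwd q p) = trans (sym (foldl-merge-joins (λ w → w) P (sub _ q))) (walk⇒same-label P sub p)

    subsets⇒interleaving : ∀ {X : Set} (L A : List X) → A ∈ subsets L → ∃ λ R → Interleaving A R L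
    subsets⇒interleaving [] A (here refl) = [] , []
    subsets⇒interleaving (e ∷ L) A A∈ with ∈-++⁻ (subsets L) A∈
    ... | inj₁ A∈′ = let R , split = subsets⇒interleaving L A A∈′ in e ∷ R , consʳ split
    ... | inj₂ A∈′ with ∈-map⁻ (e ∷_) A∈′
    ...   | A′ , A′∈ , refl = let R , split = subsets⇒interleaving L A′ A′∈ in R , consˡ split

    joins : List Edge → Edge → ℕ
    joins P (u , v) = if ⌊ label P u ≟ label P v ⌋ then 0 else 1

    rankGain : List Edge → List Edge → ℕ
    rankGain P []      = 0
    rankGain P (e ∷ A) = joins P e + rankGain (P ++ [ e ]) A

    joins≤1 : ∀ P e → joins P e ≤ 1
    joins≤1 P (u , v) with label P u ≟ label P v
    ... | yes _ = z≤n
    ... | no _  = s≤s z≤n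

    joins-same : ∀ P u v → label P u ≡ label P v → joins P (u , v) ≡ 0
    joins-same P u v eq with label P u ≟ label P v
    ... | yes _   = refl
    ... | no  neq = ⊥-elim (neq eq)

    module Rank (vs : List V) (vs-unique : Unique vs) (vs-complete : ∀ w → w ∈ vs) where

      fixedPoints : (V → V) → ℕ
      fixedPoints f = count (λ w → f w ≟ w) vs

      fixedPoints-merge-same : ∀ f u v → f u ≡ f v → fixedPoints (merge f (u , v)) ≡ fixedPoints f
      fixedPoints-merge-same f u v fu≡fv =
        count-cong _ _ vs (λ w _ fix → trans (sym (unchanged w)) fix) (λ w _ fix → trans (unchanged w) fix)
        where
        unchanged : ∀ w → merge f (u , v) w ≡ f w
        unchanged w with f w ≟ f v
        ... | yes fw≡fv = trans fu≡fv (sym fw≡fv)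
        ... | no _      = refl

      -- Merging two classes loses exactly one representative, namely f v.
      fixedPoints-merge-distinct : ∀ f u v → Idempotent f → ¬ f u ≡ f v →
                                   fixedPoints f ≡ suc (fixedPoints (merge f (u , v)))
      fixedPoints-merge-distinct f u v idem fu≢fv =
        count-remove _ _ vs vs-unique (vs-complete (f v)) (idem v) lost others
        where
        g = merge f (u , v)
        lost : ¬ g (f v) ≡ f v
        lost with f (f v) ≟ f v
        ... | yes _    = fu≢fv
        ... | no ¬idem = ⊥-elim (¬idem (idem v))
        others : ∀ w → w ∈ vs → ¬ w ≡ f v → (f w ≡ w → g w ≡ w) × (g w ≡ w → f w ≡ w)
        others w _ w≢fv with f w ≟ f v
        ... | yes fw≡fv = (λ fw≡w → ⊥-elim (w≢fv (trans (sym fw≡w) fw≡fv)))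
                        , (λ fu≡w → ⊥-elim (fu≢fv (trans (sym (idem u)) (trans (cong f fu≡w) fw≡fv))))
        ... | no _      = (λ fix → fix) , (λ fix → fix)

      fixedPoints-id : fixedPoints (λ w → w) ≡ length vs
      fixedPoints-id = all vs
        where
        all : ∀ ws → count (λ w → w ≟ w) ws ≡ length ws
        all []       = refl
        all (w ∷ ws) = trans (count-accept (λ w → w ≟ w) ws refl) (cong suc (all ws))

      fixedPoints-const : ∀ f c → Idempotent f → (∀ w → f w ≡ c) → fixedPoints f ≡ 1
      fixedPoints-const f c idem const =
        count≡1 _ vs vs-unique (vs-complete c) (trans (cong f (sym (const c))) (trans (idem c) (const c)))
                (λ w fw≡w → trans (sym fw≡w) (const w))

      components-snoc : ∀ P e → components vs P ≡ components vs (P ++ [ e ]) + joins P e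
      components-snoc P (u , v) rewrite foldl-++ merge (λ w → w) P [ (u , v) ] with label P u ≟ label P v
      ... | yes eq  = trans (sym (fixedPoints-merge-same (label P) u v eq)) (sym (ℕ.+-identityʳ _))
      ... | no  neq = trans (fixedPoints-merge-distinct (label P) u v (label-idempotent P) neq) (ℕ.+-comm 1 _)

      components-++ : ∀ P A → components vs P ≡ components vs (P ++ A) + rankGain P A
      components-++ P []      rewrite ++-identityʳ P = sym (ℕ.+-identityʳ _)
      components-++ P (e ∷ A) = begin
        components vs P                                             ≡⟨ components-snoc P e ⟩
        components vs (P ++ [ e ]) + joins P e                      ≡⟨ cong (_+ joins P e) (components-++ (P ++ [ e ]) A) ⟩
        components vs ((P ++ [ e ]) ++ A) + rankGain (P ++ [ e ]) A + joins P e
          ≡⟨ cong (λ L → components vs L + rankGain (P ++ [ e ]) A + joins P e) (++-assoc P [ e ] A) ⟩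
        components vs (P ++ e ∷ A) + rankGain (P ++ [ e ]) A + joins P e
          ≡⟨ swap (components vs (P ++ e ∷ A)) (rankGain (P ++ [ e ]) A) (joins P e) ⟩
        components vs (P ++ e ∷ A) + rankGain P (e ∷ A)             ∎
        where
        open ≡-Reasoning
        swap : ∀ a b c → a + b + c ≡ a + (c + b)
        swap = solve-∀

      length≡components+rankGain : ∀ A → length vs ≡ components vs A + rankGain [] A
      length≡components+rankGain A = trans (sym fixedPoints-id) (components-++ [] A)

      rank≡rankGain : ∀ A → rank vs A ≡ rankGain [] A
      rank≡rankGain A =
        trans (cong (_∸ components vs A) (trans (length≡components+rankGain A) (ℕ.+-comm _ (rankGain [] A))))
              (ℕ.m+n∸n≡m (rankGain [] A) (components vs A))

      connected⇒components≡1 : ∀ A w₀ → (∀ w → Walk (_∈ A) w w₀) → components vs A ≡ 1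
      connected⇒components≡1 A w₀ conn =
        fixedPoints-const (label A) (label A w₀) (label-idempotent A)
                          (λ w → walk⇒same-label A (λ _ e∈ → e∈) (conn w))

  module CycleDecomposition
    {V : Set} (_≟_ : DecidableEquality V) (vs : List V) (vs-unique : Unique vs) (vs-complete : ∀ w → w ∈ vs)
    {I : Set} (_≟I_ : DecidableEquality I) (Ids : List I) (Ids-unique : Unique Ids) (cycleOf : V × V → I)
    where

    open Components _≟_
    open Rank vs vs-unique vs-complete

    countOn : I → List Edge → ℕ
    countOn j L = count (λ e → cycleOf e ≟I j) L

    OnCycles : List Edge → Set
    OnCycles L = All (λ e → cycleOf e ∈ Ids) L

    sumOver-countOn : ∀ L → OnCycles L → sumOver Ids (λ j → countOn j L) ≡ length L
    sumOver-countOn L L-on = sumOver-fibres _≟I_ cycleOf Ids Ids-unique L (λ _ → All.lookup L-on)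

    private
      shiftAt : Edge → (I → ℕ → ℤ) → I → ℕ → ℤ
      shiftAt e h j = if ⌊ cycleOf e ≟I j ⌋ then (λ c → h j (suc c)) else h j

      shiftAt-countOn : ∀ e h j A → h j (countOn j (e ∷ A)) ≡ shiftAt e h j (countOn j A)
      shiftAt-countOn e h j A with cycleOf e ≟I j
      ... | yes _ = refl
      ... | no _  = refl

      sumℤ-++ : ∀ xs ys → sumℤ (xs ++ ys) ≡ sumℤ xs ℤ.+ sumℤ ys
      sumℤ-++ []       ys = sym (ℤ.+-identityˡ _)
      sumℤ-++ (x ∷ xs) ys = trans (cong (λ s → x ℤ.+ s) (sumℤ-++ xs ys)) (sym (ℤ.+-assoc x _ _))

    sum-subsets-prodOver : ∀ L → OnCycles L → (h : I → ℕ → ℤ) →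
      sumℤ (map (λ A → prodOver Ids (λ j → h j (countOn j A))) (subsets L))
        ≡ prodOver Ids (λ j → binomSum (countOn j L) (h j))
    sum-subsets-prodOver []      []          h = ℤ.+-identityʳ _
    sum-subsets-prodOver (e ∷ L) (e∈ ∷ L-on) h = begin
      sumℤ (map G (subsets L ++ map (e ∷_) (subsets L)))
        ≡⟨ cong sumℤ (map-++ G (subsets L) (map (e ∷_) (subsets L))) ⟩
      sumℤ (map G (subsets L) ++ map G (map (e ∷_) (subsets L)))
        ≡⟨ sumℤ-++ (map G (subsets L)) _ ⟩
      sumℤ (map G (subsets L)) ℤ.+ sumℤ (map G (map (e ∷_) (subsets L)))
        ≡⟨ cong (λ z → sumℤ (map G (subsets L)) ℤ.+ sumℤ z)
                (trans (sym (map-∘ (subsets L))) (map-cong G-cons (subsets L))) ⟩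
      sumℤ (map G (subsets L)) ℤ.+ sumℤ (map (λ A → prodOver Ids (λ j → shiftAt e h j (countOn j A))) (subsets L))
        ≡⟨ cong₂ ℤ._+_ (sum-subsets-prodOver L L-on h) (sum-subsets-prodOver L L-on (shiftAt e h)) ⟩
      prodOver Ids (λ j → binomSum (countOn j L) (h j))
        ℤ.+ prodOver Ids (λ j → binomSum (countOn j L) (shiftAt e h j))
        ≡⟨ prodOver-+-at Ids Ids-unique e∈ _ _ _ off-e off-e′ at-e ⟩
      prodOver Ids (λ j → binomSum (countOn j (e ∷ L)) (h j)) ∎
      where
      open ≡-Reasoning
      G : List Edge → ℤ
      G A = prodOver Ids (λ j → h j (countOn j A))
      G-cons : ∀ A → G (e ∷ A) ≡ prodOver Ids (λ j → shiftAt e h j (countOn j A))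
      G-cons A = prodOver-cong Ids (λ j _ → shiftAt-countOn e h j A)
      off-e : ∀ j → j ∈ Ids → ¬ j ≡ cycleOf e →
              binomSum (countOn j L) (h j) ≡ binomSum (countOn j (e ∷ L)) (h j)
      off-e j _ j≢ with cycleOf e ≟I j
      ... | yes eq = ⊥-elim (j≢ (sym eq))
      ... | no _   = refl
      off-e′ : ∀ j → j ∈ Ids → ¬ j ≡ cycleOf e →
               binomSum (countOn j L) (shiftAt e h j) ≡ binomSum (countOn j (e ∷ L)) (h j)
      off-e′ j _ j≢ with cycleOf e ≟I j
      ... | yes eq = ⊥-elim (j≢ (sym eq))
      ... | no _   = refl
      at-e : binomSum (countOn (cycleOf e) L) (h (cycleOf e))
               ℤ.+ binomSum (countOn (cycleOf e) L) (shiftAt e h (cycleOf e))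
             ≡ binomSum (countOn (cycleOf e) (e ∷ L)) (h (cycleOf e))
      at-e with cycleOf e ≟I cycleOf e
      ... | yes _   = refl
      ... | no  neq = ⊥-elim (neq refl)

    OtherEdgeOnCycle : List Edge → Edge → Edge → Set
    OtherEdgeOnCycle E e e′ = e′ ∈ E × cycleOf e′ ≡ cycleOf e × ¬ e′ ≡ e

    -- The edges of a connected graph are grouped into classes ("cycles") so that no edge is a bridge of its class
    -- and the cyclomatic number |E| - |V| + 1 is the number of classes. Then the nullity of every A ⊆ E is the
    -- number of classes A contains entirely, and T factors over the classes.
    record IsCactus (E : List Edge) : Set where
      field
        edges-unique    : Unique E
        edges-on-cycles : OnCycles E
        cycle-nonempty  : ∀ j → j ∈ Ids → 1 ≤ countOn j E
        cycle-closed    : ∀ e → e ∈ E → Walk (OtherEdgeOnCycle E e) (proj₁ e) (proj₂ e)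
        root            : V
        connected       : ∀ w → Walk (_∈ E) w root
        cyclomatic      : length E + 1 ≡ length vs + length Ids

    module _ {E : List Edge} (cactus : IsCactus E) where

      open IsCactus cactus

      _≟E_ : DecidableEquality Edge
      _≟E_ = ×-≡-dec _≟_ _≟_

      Complete : I → List Edge → Set
      Complete j L = All (λ e → cycleOf e ≡ j → e ∈ L) E

      complete? : ∀ j L → Dec (Complete j L)
      complete? j L = all? (λ e → (cycleOf e ≟I j) →-dec (e ∈? L)) E
        where open import Data.List.Membership.DecPropositional _≟E_ using (_∈?_)

      CompletedBy : List Edge → List Edge → I → Set
      CompletedBy P A j = (¬ countOn j A ≡ 0) × Complete j (P ++ A)

      completedBy : List Edge → List Edge → ℕ
      completedBy P A = count (λ j → ¬? (countOn j A ℕ.≟ 0) ×-dec complete? j (P ++ A)) Ids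

      private
        completedBy-step : ∀ P a A j → ¬ j ≡ cycleOf a → CompletedBy P (a ∷ A) j → CompletedBy (P ++ [ a ]) A j
        completedBy-step P a A j j≢ (nonzero , complete) =
          subst (λ n → ¬ n ≡ 0) (count-reject (λ e → cycleOf e ≟I j) A (λ eq → j≢ (sym eq))) nonzero
          , subst (Complete j) (sym (++-assoc P [ a ] A)) complete

        closing-edge-joins-nothing : ∀ P a A → a ∈ E → Complete (cycleOf a) (P ++ a ∷ A) →
                                     countOn (cycleOf a) A ≡ 0 → joins P a ≡ 0
        closing-edge-joins-nothing P a A a∈ complete none-later =
          joins-same P (proj₁ a) (proj₂ a) (walk⇒same-label P in-P (cycle-closed a a∈))
          where
          in-P : ∀ e′ → OtherEdgeOnCycle E a e′ → e′ ∈ P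
          in-P e′ (e′∈ , same , e′≢a) with ∈-++⁻ P (All.lookup complete e′∈ same)
          ... | inj₁ e′∈P         = e′∈P
          ... | inj₂ (here e′≡a)  = ⊥-elim (e′≢a e′≡a)
          ... | inj₂ (there e′∈A) = ⊥-elim (count≡0⇒¬ _ A none-later e′∈A same)

        edge-not-closing : ∀ P a A → rankGain (P ++ [ a ]) A + completedBy (P ++ [ a ]) A ≤ length A →
                           (CompletedBy P (a ∷ A) (cycleOf a) → CompletedBy (P ++ [ a ]) A (cycleOf a)) →
                           joins P a + rankGain (P ++ [ a ]) A + completedBy P (a ∷ A) ≤ suc (length A)
        edge-not-closing P a A ih step-a = begin
          joins P a + rankGain P′ A + completedBy P (a ∷ A)
            ≤⟨ ℕ.+-mono-≤ (ℕ.+-monoˡ-≤ (rankGain P′ A) (joins≤1 P a)) (count-mono _ _ Ids step) ⟩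
          suc (rankGain P′ A + completedBy P′ A)  ≤⟨ s≤s ih ⟩
          suc (length A)                          ∎
          where
          open ℕ.≤-Reasoning
          P′ = P ++ [ a ]
          step : ∀ j → j ∈ Ids → CompletedBy P (a ∷ A) j → CompletedBy P′ A j
          step j _ completed with j ≟I cycleOf a
          ... | yes refl = step-a completed
          ... | no j≢    = completedBy-step P a A j j≢ completed

        edge-closing : ∀ P a A → rankGain (P ++ [ a ]) A + completedBy (P ++ [ a ]) A ≤ length A →
                       joins P a ≡ 0 →
                       joins P a + rankGain (P ++ [ a ]) A + completedBy P (a ∷ A) ≤ suc (length A)
        edge-closing P a A ih joins≡0 = begin
          joins P a + rankGain P′ A + completedBy P (a ∷ A)
            ≡⟨ cong (λ s → s + rankGain P′ A + completedBy P (a ∷ A)) joins≡0 ⟩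
          rankGain P′ A + completedBy P (a ∷ A)
            ≤⟨ ℕ.+-monoʳ-≤ (rankGain P′ A)
                           (count-mono-except _ _ Ids Ids-unique (λ j _ j≢ → completedBy-step P a A j j≢)) ⟩
          rankGain P′ A + suc (completedBy P′ A)  ≡⟨ ℕ.+-suc (rankGain P′ A) _ ⟩
          suc (rankGain P′ A + completedBy P′ A)  ≤⟨ s≤s ih ⟩
          suc (length A)                          ∎
          where
          open ℕ.≤-Reasoning
          P′ = P ++ [ a ]

      -- Each edge either raises the rank or completes at most one cycle.
      rankGain+completedBy≤length : ∀ P A → All (_∈ E) A → rankGain P A + completedBy P A ≤ length A
      rankGain+completedBy≤length P [] [] =
        ℕ.≤-reflexive (count-none _ Ids (λ j _ completed → proj₁ completed refl))
      rankGain+completedBy≤length P (a ∷ A) (a∈ ∷ A⊆E)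
        with rankGain+completedBy≤length (P ++ [ a ]) A A⊆E
           | complete? (cycleOf a) (P ++ a ∷ A) | countOn (cycleOf a) A ℕ.≟ 0
      ... | ih | yes complete | yes none-later =
        edge-closing P a A ih (closing-edge-joins-nothing P a A a∈ complete none-later)
      ... | ih | yes _ | no some-later = edge-not-closing P a A ih
        λ (_ , complete) → some-later , subst (Complete (cycleOf a)) (sym (++-assoc P [ a ] A)) complete
      ... | ih | no incomplete | _ = edge-not-closing P a A ih (λ completed → ⊥-elim (incomplete (proj₂ completed)))

      rank-E : rank vs E ≡ length vs ∸ 1
      rank-E = cong (length vs ∸_) (connected⇒components≡1 E root connected)

      sumOver-countOn∸1 : sumOver Ids (λ j → countOn j E ∸ 1) ≡ length vs ∸ 1
      sumOver-countOn∸1 = begin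
        S                     ≡⟨ sym (ℕ.m+n∸n≡m S 1) ⟩
        S + 1 ∸ 1             ≡⟨ cong (_∸ 1) (ℕ.+-cancelʳ-≡ (length Ids) _ _ S+1+Ids) ⟩
        length vs ∸ 1         ∎
        where
        open ≡-Reasoning
        S = sumOver Ids (λ j → countOn j E ∸ 1)
        S+Ids : S + length Ids ≡ length E
        S+Ids = trans (sumOver-∸1 Ids (λ j → countOn j E) cycle-nonempty) (sumOver-countOn E edges-on-cycles)
        S+1+Ids : S + 1 + length Ids ≡ length vs + length Ids
        S+1+Ids = trans (ℕ.+-assoc S 1 (length Ids)) (trans (cong (S +_) (ℕ.+-comm 1 (length Ids)))
                    (trans (sym (ℕ.+-assoc S (length Ids) 1)) (trans (cong (_+ 1) S+Ids) cyclomatic)))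

      fullCycles : List Edge → ℕ
      fullCycles A = count (λ j → countOn j A ℕ.≟ countOn j E) Ids

      private
        in-E⇒in-A++R : ∀ {A R} → Interleaving A R E → ∀ {e} → e ∈ E → e ∈ A ++ R
        in-E⇒in-A++R {A} split e∈E = [ ∈-++⁺ˡ , ∈-++⁺ʳ A ]′ (interleaving-∈⁻ split e∈E)

      module _ {A R : List Edge} (split : Interleaving A R E) where

        private
          countOn-split : ∀ j → countOn j A + countOn j R ≡ countOn j E
          countOn-split j = count-interleaving (λ e → cycleOf e ≟I j) split

          full⇒none-in-R : ∀ j → countOn j A ≡ countOn j E → countOn j R ≡ 0
          full⇒none-in-R j full =
            ℕ.+-cancelˡ-≡ (countOn j A) _ _ (trans (countOn-split j) (trans (sym full) (sym (ℕ.+-identityʳ _))))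

          none-in-R⇒full : ∀ j → countOn j R ≡ 0 → countOn j A ≡ countOn j E
          none-in-R⇒full j none =
            trans (sym (ℕ.+-identityʳ _)) (trans (cong (countOn j A +_) (sym none)) (countOn-split j))

        completedBy-[]≡fullCycles : completedBy [] A ≡ fullCycles A
        completedBy-[]≡fullCycles = count-cong _ _ Ids to from
          where
          to : ∀ j → j ∈ Ids → CompletedBy [] A j → countOn j A ≡ countOn j E
          to j _ (_ , complete) with countOn j R ℕ.≟ 0
          ... | yes none = none-in-R⇒full j none
          ... | no some with count≢0⇒∃ (λ e → cycleOf e ≟I j) R some
          ...   | e , e∈R , on-j =
            ⊥-elim (interleaving-disjoint split edges-unique
                                          (All.lookup complete (interleaving-∈ʳ split e∈R) on-j) e∈R)
          from : ∀ j → j ∈ Ids → countOn j A ≡ countOn j E → CompletedBy [] A j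
          from j j∈ full =
            (λ none → ℕ.m<n⇒n≢0 (cycle-nonempty j j∈) (trans (sym full) none))
            , All.tabulate (λ {e} e∈E on-j →
                [ (λ e∈A → e∈A) , (λ e∈R → ⊥-elim (count≡0⇒¬ _ R (full⇒none-in-R j full) e∈R on-j)) ]′
                (interleaving-∈⁻ split e∈E))

        completedBy+fullCycles : completedBy A R + fullCycles A ≡ length Ids
        completedBy+fullCycles =
          trans (ℕ.+-comm (completedBy A R) (fullCycles A))
                (trans (cong (fullCycles A +_) (count-cong _ _ Ids to from)) (count+count-∁ _ Ids))
          where
          to : ∀ j → j ∈ Ids → CompletedBy A R j → ¬ countOn j A ≡ countOn j E
          to j _ (some , _) full = some (full⇒none-in-R j full)
          from : ∀ j → j ∈ Ids → ¬ countOn j A ≡ countOn j E → CompletedBy A R j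
          from j _ ¬full =
            (λ none → ¬full (none-in-R⇒full j none)) , All.tabulate (λ e∈E _ → in-E⇒in-A++R split e∈E)

        length-vs≡rankGains : length vs ≡ suc (rankGain A R + rankGain [] A)
        length-vs≡rankGains = begin
          length vs                                                ≡⟨ length≡components+rankGain A ⟩
          components vs A + rankGain [] A                          ≡⟨ cong (_+ rankGain [] A) (components-++ A R) ⟩
          components vs (A ++ R) + rankGain A R + rankGain [] A
            ≡⟨ cong (λ c → c + rankGain A R + rankGain [] A) connected-A++R ⟩
          suc (rankGain A R + rankGain [] A)                       ∎
          where
          open ≡-Reasoning
          connected-A++R : components vs (A ++ R) ≡ 1
          connected-A++R =
            connected⇒components≡1 (A ++ R) root (λ w → walk-map (λ _ → in-E⇒in-A++R split) (connected w))

        rankGain+fullCycles≡length : rankGain [] A + fullCycles A ≡ length A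
        rankGain+fullCycles≡length = ℕ.≤-antisym upper lower
          where
          upper : rankGain [] A + fullCycles A ≤ length A
          upper = subst (λ s → rankGain [] A + s ≤ length A) completedBy-[]≡fullCycles
                        (rankGain+completedBy≤length [] A (All.tabulate (interleaving-∈ˡ split)))
          euler : length A + suc (length R) ≡ (rankGain [] A + fullCycles A) + suc (rankGain A R + completedBy A R)
          euler = begin
            length A + suc (length R)                  ≡⟨ ℕ.+-suc (length A) (length R) ⟩
            suc (length A + length R)                  ≡⟨ cong suc (sym (interleave-length split)) ⟩
            suc (length E)                             ≡⟨ ℕ.+-comm 1 (length E) ⟩
            length E + 1                               ≡⟨ cyclomatic ⟩
            length vs + length Ids
              ≡⟨ cong₂ _+_ length-vs≡rankGains (sym completedBy+fullCycles) ⟩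
            suc (rankGain A R + rankGain [] A) + (completedBy A R + fullCycles A)
              ≡⟨ rearrange (rankGain A R) (rankGain [] A) (completedBy A R) (fullCycles A) ⟩
            (rankGain [] A + fullCycles A) + suc (rankGain A R + completedBy A R) ∎
            where
            open ≡-Reasoning
            rearrange : ∀ a b c d → suc (a + b) + (c + d) ≡ (b + d) + suc (a + c)
            rearrange = solve-∀
          lower : length A ≤ rankGain [] A + fullCycles A
          lower = ℕ.+-cancelʳ-≤ (suc (length R)) _ _ (begin
            length A + suc (length R)                                    ≡⟨ euler ⟩
            (rankGain [] A + fullCycles A) + suc (rankGain A R + completedBy A R)
              ≤⟨ ℕ.+-monoʳ-≤ (rankGain [] A + fullCycles A)
                             (s≤s (rankGain+completedBy≤length A R (All.tabulate (interleaving-∈ʳ split)))) ⟩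
            (rankGain [] A + fullCycles A) + suc (length R)              ∎)
            where open ℕ.≤-Reasoning

        private
          exponent-sum : sumOver Ids (λ j → cycleExponent (countOn j E) (countOn j A)) + length A
                         ≡ (length vs ∸ 1) + fullCycles A
          exponent-sum = begin
            Σex + length A                                      ≡⟨ cong (Σex +_) (sym (sumOver-countOn A A-on-cycles)) ⟩
            Σex + sumOver Ids (λ j → countOn j A)               ≡⟨ sym (sumOver-+ Ids ex (λ j → countOn j A)) ⟩
            sumOver Ids (λ j → ex j + countOn j A)              ≡⟨ sumOver-cong Ids per-cycle ⟩
            sumOver Ids (λ j → (countOn j E ∸ 1) + isFull (countOn j E) (countOn j A))
              ≡⟨ sumOver-+ Ids _ _ ⟩
            sumOver Ids (λ j → countOn j E ∸ 1) + sumOver Ids (λ j → isFull (countOn j E) (countOn j A))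
              ≡⟨ cong₂ _+_ sumOver-countOn∸1 (sumOver-indicator (λ j → countOn j A ℕ.≟ countOn j E) Ids) ⟩
            (length vs ∸ 1) + fullCycles A                     ∎
            where
            open ≡-Reasoning
            ex : I → ℕ
            ex j = cycleExponent (countOn j E) (countOn j A)
            Σex = sumOver Ids ex
            A-on-cycles : OnCycles A
            A-on-cycles = All.tabulate (λ e∈A → All.lookup edges-on-cycles (interleaving-∈ˡ split e∈A))
            countOn-A≤E : ∀ j → countOn j A ≤ countOn j E
            countOn-A≤E j = subst (countOn j A ≤_) (countOn-split j) (ℕ.m≤m+n _ _)
            per-cycle : ∀ j → j ∈ Ids →
                        ex j + countOn j A ≡ (countOn j E ∸ 1) + isFull (countOn j E) (countOn j A)
            per-cycle j j∈ = cycleExponent+count (countOn j E) (countOn j A) (countOn-A≤E j) (cycle-nonempty j j∈)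

          nullity-exponent : sumOver Ids (λ j → isFull (countOn j E) (countOn j A)) ≡ length A ∸ rank vs A
          nullity-exponent = begin
            sumOver Ids (λ j → isFull (countOn j E) (countOn j A))
              ≡⟨ sumOver-indicator (λ j → countOn j A ℕ.≟ countOn j E) Ids ⟩
            fullCycles A          ≡⟨ sym (ℕ.m+n∸m≡n r (fullCycles A)) ⟩
            r + fullCycles A ∸ r  ≡⟨ cong₂ _∸_ rankGain+fullCycles≡length (sym (rank≡rankGain A)) ⟩
            length A ∸ rank vs A  ∎
            where
            open ≡-Reasoning
            r = rankGain [] A

          corank-exponent : sumOver Ids (λ j → cycleExponent (countOn j E) (countOn j A)) ≡ rank vs E ∸ rank vs A
          corank-exponent = begin
            Σex                 ≡⟨ sym (ℕ.m+n∸n≡m Σex r) ⟩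
            Σex + r ∸ r         ≡⟨ cong₂ _∸_ (trans Σex+r (sym rank-E)) (sym (rank≡rankGain A)) ⟩
            rank vs E ∸ rank vs A ∎
            where
            open ≡-Reasoning
            r = rankGain [] A
            Σex = sumOver Ids (λ j → cycleExponent (countOn j E) (countOn j A))
            Σex+r : Σex + r ≡ length vs ∸ 1
            Σex+r = ℕ.+-cancelʳ-≡ (fullCycles A) _ _ (begin
              Σex + r + fullCycles A        ≡⟨ ℕ.+-assoc Σex r (fullCycles A) ⟩
              Σex + (r + fullCycles A)      ≡⟨ cong (Σex +_) rankGain+fullCycles≡length ⟩
              Σex + length A                ≡⟨ exponent-sum ⟩
              (length vs ∸ 1) + fullCycles A ∎)

        tutte-summand : ∀ x y → (x - 1ℤ) ^ (rank vs E ∸ rank vs A) ℤ.* (y - 1ℤ) ^ (length A ∸ rank vs A)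
                                ≡ prodOver Ids (λ j → cycleWeight x y (countOn j E) (countOn j A))
        tutte-summand x y = sym (begin
          prodOver Ids (λ j → cycleWeight x y (countOn j E) (countOn j A))
            ≡⟨ prodOver-cong Ids (λ j _ → cycleWeight-powers x y (countOn j E) (countOn j A)) ⟩
          prodOver Ids (λ j → (x - 1ℤ) ^ ex j ℤ.* (y - 1ℤ) ^ full j)
            ≡⟨ prodOver-* Ids _ _ ⟩
          prodOver Ids (λ j → (x - 1ℤ) ^ ex j) ℤ.* prodOver Ids (λ j → (y - 1ℤ) ^ full j)
            ≡⟨ cong₂ ℤ._*_ (prodOver-^ Ids (x - 1ℤ) ex) (prodOver-^ Ids (y - 1ℤ) full) ⟩
          (x - 1ℤ) ^ sumOver Ids ex ℤ.* (y - 1ℤ) ^ sumOver Ids full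
            ≡⟨ cong₂ (λ a b → (x - 1ℤ) ^ a ℤ.* (y - 1ℤ) ^ b) corank-exponent nullity-exponent ⟩
          (x - 1ℤ) ^ (rank vs E ∸ rank vs A) ℤ.* (y - 1ℤ) ^ (length A ∸ rank vs A) ∎)
          where
          open ≡-Reasoning
          ex full : I → ℕ
          ex j = cycleExponent (countOn j E) (countOn j A)
          full j = isFull (countOn j E) (countOn j A)

      tutte-cactus : ∀ x y → tutte vs E x y ≡ prodOver Ids (λ j → geo (countOn j E) x y)
      tutte-cactus x y = begin
        tutte vs E x y
          ≡⟨ cong sumℤ (map-cong-local (All.tabulate λ {A} A∈ →
                          tutte-summand (proj₂ (subsets⇒interleaving E A A∈)) x y)) ⟩
        sumℤ (map (λ A → prodOver Ids (λ j → cycleWeight x y (countOn j E) (countOn j A))) (subsets E))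
          ≡⟨ sum-subsets-prodOver E edges-on-cycles (λ j → cycleWeight x y (countOn j E)) ⟩
        prodOver Ids (λ j → binomSum (countOn j E) (cycleWeight x y (countOn j E)))
          ≡⟨ prodOver-cong Ids cycle-factor ⟩
        prodOver Ids (λ j → geo (countOn j E) x y) ∎
        where
        open ≡-Reasoning
        cycle-factor : ∀ j → j ∈ Ids →
                       binomSum (countOn j E) (cycleWeight x y (countOn j E)) ≡ geo (countOn j E) x y
        cycle-factor j j∈ with countOn j E | cycle-nonempty j j∈
        ... | suc m | _ = binomSum-cycleWeight x y m

module Basilica where

  open import Data.Bool using (Bool; true; false; if_then_else_)
  open import Data.Bool.Properties using () renaming (_≟_ to _≟B_)
  open import Data.Empty using (⊥-elim)
  open import Data.Nat as ℕ using (ℕ; zero; suc; _+_; _≤_)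
  import Data.Integer as ℤ
  open import Data.Integer using (ℤ)
  import Data.Nat.Properties as ℕ
  open import Data.Nat.Tactic.RingSolver using (solve-∀)
  open import Data.Vec using ([]; _∷_; head)
  open import Data.Vec.Properties using (∷-injectiveʳ)
  open import Data.List using (List; []; _∷_; _++_; map; length)
  open import Data.List.Properties using (length-++; length-map; map-++; ++-assoc; ++-identityʳ)
  open import Data.List.Membership.Propositional using (_∈_; find; lose)
  open import Data.List.Membership.Propositional.Properties
    using (∈-++⁻; ∈-++⁺ˡ; ∈-++⁺ʳ; ∈-map⁻; ∈-map⁺; ∈-concatMap⁺; ∈-concatMap⁻)
  open import Data.List.Relation.Unary.Any using (here)
  open import Data.List.Relation.Unary.All as All using ([])
  open import Data.List.Relation.Unary.Unique.Propositional using (Unique; []; _∷_)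
  import Data.List.Relation.Unary.Unique.Propositional.Properties as Unique
  open import Data.Product using (_×_; _,_; proj₁; proj₂; ∃-syntax)
  open import Data.Sum using (_⊎_; inj₁; inj₂)
  open import Relation.Nullary using (Dec; yes; no; ¬_)
  open import Relation.Nullary.Decidable using (⌊_⌋)
  open import Function using (_∘_; case_of_)
  open import Relation.Binary using (DecidableEquality)
  open import Data.Product.Properties using () renaming (≡-dec to ×-≡-dec)
  open import Relation.Binary.PropositionalEquality
  open import Defs
  open Counting
  open Products
  open Cactus using (Walk; []; fwd; walk-bind; walk-map; walk-reverse)

  0∷≢1∷ : ∀ {m} {u v : Word m} → ¬ _≡_ {A = Word (suc m)} (false ∷ u) (true ∷ v)
  0∷≢1∷ ()

  allWords-unique : ∀ m → Unique (allWords m)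
  allWords-unique zero    = [] ∷ []
  allWords-unique (suc m) =
    Unique.++⁺ (Unique.map⁺ ∷-injectiveʳ (allWords-unique m)) (Unique.map⁺ ∷-injectiveʳ (allWords-unique m))
               disjoint
    where
    disjoint : ∀ {w} → ¬ (w ∈ map (false ∷_) (allWords m) × w ∈ map (true ∷_) (allWords m))
    disjoint (w∈₀ , w∈₁) with ∈-map⁻ (false ∷_) w∈₀ | ∈-map⁻ (true ∷_) w∈₁
    ... | _ , _ , refl | _ , _ , eq = 0∷≢1∷ eq

  ∈-allWords : ∀ m (w : Word m) → w ∈ allWords m
  ∈-allWords zero    []          = here refl
  ∈-allWords (suc m) (false ∷ w) = ∈-++⁺ˡ (∈-map⁺ (false ∷_) (∈-allWords m w))
  ∈-allWords (suc m) (true ∷ w)  = ∈-++⁺ʳ (map (false ∷_) (allWords m)) (∈-map⁺ (true ∷_) (∈-allWords m w))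

  length-allWords-suc : ∀ m → length (allWords (suc m)) ≡ length (allWords m) + length (allWords m)
  length-allWords-suc m =
    trans (length-++ (map (false ∷_) (allWords m))) (cong₂ _+_ (length-map _ (allWords m)) (length-map _ (allWords m)))

  length-allWords : ∀ m → length (allWords m) ≡ 2 ℕ.^ m
  length-allWords zero    = refl
  length-allWords (suc m) =
    trans (length-allWords-suc m)
          (trans (cong₂ _+_ (length-allWords m) (length-allWords m)) (cong (2 ℕ.^ m +_) (sym (ℕ.+-identityʳ _))))

  head-basA : ∀ {m} (u : Word (suc m)) → head (basA u) ≡ head u
  head-basA (false ∷ w) = refl
  head-basA (true ∷ w)  = refl

  head-basB : ∀ {m} (u : Word (suc m)) → ¬ head (basB u) ≡ head u
  head-basB (false ∷ w) ()
  head-basB (true ∷ w)  ()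

  basB-moves : ∀ {m} (u : Word (suc m)) → ¬ basB u ≡ u
  basB-moves u eq = head-basB u (cong head eq)

  -- repA u and repB u are canonical representatives of the ⟨a⟩- and ⟨b⟩-orbits of u.
  mutual
    repA : ∀ {m} → Word m → Word m
    repA []          = []
    repA (false ∷ w) = false ∷ repB w
    repA (true ∷ w)  = true ∷ w

    repB : ∀ {m} → Word m → Word m
    repB []      = []
    repB (_ ∷ w) = false ∷ repA w

  mutual
    repA-basA : ∀ {m} (u : Word m) → repA (basA u) ≡ repA u
    repA-basA []          = refl
    repA-basA (false ∷ w) = cong (false ∷_) (repB-basB w)
    repA-basA (true ∷ w)  = refl

    repB-basB : ∀ {m} (u : Word m) → repB (basB u) ≡ repB u
    repB-basB []          = refl
    repB-basB (false ∷ w) = cong (false ∷_) (repA-basA w)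
    repB-basB (true ∷ w)  = refl

  mutual
    repA-fixed : ∀ {m} (u : Word m) → basA u ≡ u → repA u ≡ u
    repA-fixed []          _  = refl
    repA-fixed (false ∷ w) eq = cong (false ∷_) (repB-fixed w (∷-injectiveʳ eq))
    repA-fixed (true ∷ w)  _  = refl

    repB-fixed : ∀ {m} (u : Word m) → basB u ≡ u → repB u ≡ u
    repB-fixed []          _ = refl
    repB-fixed (false ∷ w) ()
    repB-fixed (true ∷ w)  ()

  -- Representatives of the nontrivial ⟨a⟩-orbits (cyclesA), of the fixed points of a (fixedA), and likewise for b.
  mutual
    cyclesA : ∀ m → List (Word m)
    cyclesA zero    = []
    cyclesA (suc m) = map (false ∷_) (cyclesB m)

    cyclesB : ∀ m → List (Word m)
    cyclesB zero    = []
    cyclesB (suc m) = map (false ∷_) (cyclesA m ++ fixedA m)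

    fixedA : ∀ m → List (Word m)
    fixedA zero    = [] ∷ []
    fixedA (suc m) = map (false ∷_) (fixedB m) ++ map (true ∷_) (allWords m)

    fixedB : ∀ m → List (Word m)
    fixedB zero    = [] ∷ []
    fixedB (suc m) = []

  private
    ∈-map-0∷⁻ : ∀ {m} {r : Word (suc m)} {xs : List (Word m)} →
                r ∈ map (false ∷_) xs → ∃[ s ] s ∈ xs × r ≡ false ∷ s
    ∈-map-0∷⁻ r∈ = ∈-map⁻ (false ∷_) r∈

  mutual
    cyclesA-rep : ∀ m (r : Word m) → r ∈ cyclesA m → repA r ≡ r × ¬ basA r ≡ r
    cyclesA-rep (suc m) r r∈ with ∈-map-0∷⁻ r∈
    ... | s , s∈ , refl =
      let rep , moved = cyclesB-rep m s s∈ in cong (false ∷_) rep , (λ eq → moved (∷-injectiveʳ eq))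

    cyclesB-rep : ∀ m (r : Word m) → r ∈ cyclesB m → repB r ≡ r × ¬ basB r ≡ r
    cyclesB-rep (suc m) r r∈ with ∈-map-0∷⁻ r∈
    ... | s , s∈ , refl with ∈-++⁻ (cyclesA m) s∈
    ...   | inj₁ s∈A = cong (false ∷_) (proj₁ (cyclesA-rep m s s∈A)) , (λ ())
    ...   | inj₂ s∈F = cong (false ∷_) (proj₁ (fixedA-rep m s s∈F)) , (λ ())

    fixedA-rep : ∀ m (r : Word m) → r ∈ fixedA m → repA r ≡ r × basA r ≡ r
    fixedA-rep zero [] _ = refl , refl
    fixedA-rep (suc m) r r∈ with ∈-++⁻ (map (false ∷_) (fixedB m)) r∈
    ... | inj₁ r∈₀ with ∈-map-0∷⁻ r∈₀
    ...   | s , s∈ , refl = let rep , fixed = fixedB-rep m s s∈ in cong (false ∷_) rep , cong (false ∷_) fixed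
    fixedA-rep (suc m) r r∈ | inj₂ r∈₁ with ∈-map⁻ (true ∷_) r∈₁
    ...   | s , _ , refl = refl , refl

    fixedB-rep : ∀ m (r : Word m) → r ∈ fixedB m → repB r ≡ r × basB r ≡ r
    fixedB-rep zero [] _ = refl , refl

  mutual
    repA∈cyclesA : ∀ m (u : Word m) → ¬ basA u ≡ u → repA u ∈ cyclesA m
    repA∈cyclesA zero    []          moved = ⊥-elim (moved refl)
    repA∈cyclesA (suc m) (false ∷ w) moved =
      ∈-map⁺ (false ∷_) (repB∈cyclesB m w (λ eq → moved (cong (false ∷_) eq)))
    repA∈cyclesA (suc m) (true ∷ w)  moved = ⊥-elim (moved refl)

    repB∈cyclesB : ∀ m (u : Word m) → ¬ basB u ≡ u → repB u ∈ cyclesB m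
    repB∈cyclesB zero    []      moved = ⊥-elim (moved refl)
    repB∈cyclesB (suc m) (_ ∷ w) _     = ∈-map⁺ (false ∷_) (repA∈orbitsA m w)

    repA∈orbitsA : ∀ m (u : Word m) → repA u ∈ cyclesA m ++ fixedA m
    repA∈orbitsA zero    [] = here refl
    repA∈orbitsA (suc m) (false ∷ w) with repB∈orbitsB m w
    ... | inj₁ r∈ = ∈-++⁺ˡ (∈-map⁺ (false ∷_) r∈)
    ... | inj₂ r∈ = ∈-++⁺ʳ (cyclesA (suc m)) (∈-++⁺ˡ (∈-map⁺ (false ∷_) r∈))
    repA∈orbitsA (suc m) (true ∷ w) =
      ∈-++⁺ʳ (cyclesA (suc m)) (∈-++⁺ʳ (map (false ∷_) (fixedB m)) (∈-map⁺ (true ∷_) (∈-allWords m w)))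

    repB∈orbitsB : ∀ m (u : Word m) → repB u ∈ cyclesB m ⊎ repB u ∈ fixedB m
    repB∈orbitsB zero    [] = inj₂ (here refl)
    repB∈orbitsB (suc m) u  = inj₁ (repB∈cyclesB (suc m) u (basB-moves u))

  mutual
    orbitsA-unique : ∀ m → Unique (cyclesA m ++ fixedA m)
    orbitsA-unique zero    = [] ∷ []
    orbitsA-unique (suc m) = subst Unique regroup
      (Unique.++⁺ (Unique.map⁺ ∷-injectiveʳ (orbitsB-unique m)) (Unique.map⁺ ∷-injectiveʳ (allWords-unique m))
                  disjoint)
      where
      regroup : map (false ∷_) (cyclesB m ++ fixedB m) ++ map (true ∷_) (allWords m)
                ≡ cyclesA (suc m) ++ fixedA (suc m)
      regroup = trans (cong (_++ map (true ∷_) (allWords m)) (map-++ (false ∷_) (cyclesB m) (fixedB m)))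
                      (++-assoc (map (false ∷_) (cyclesB m)) (map (false ∷_) (fixedB m)) (map (true ∷_) (allWords m)))
      disjoint : ∀ {w} → ¬ (w ∈ map (false ∷_) (cyclesB m ++ fixedB m) × w ∈ map (true ∷_) (allWords m))
      disjoint (w∈₀ , w∈₁) with ∈-map⁻ (false ∷_) w∈₀ | ∈-map⁻ (true ∷_) w∈₁
      ... | _ , _ , refl | _ , _ , eq = 0∷≢1∷ eq

    orbitsB-unique : ∀ m → Unique (cyclesB m ++ fixedB m)
    orbitsB-unique zero    = [] ∷ []
    orbitsB-unique (suc m) = subst Unique (sym (++-identityʳ _)) (Unique.map⁺ ∷-injectiveʳ (orbitsA-unique m))

  data OrbitEdgeA {m} (u : Word m) : Word m × Word m → Set where
    orbit-edgeA : ∀ p → ¬ basA p ≡ p → ¬ p ≡ u → repA p ≡ repA u → OrbitEdgeA u (p , basA p)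

  data OrbitEdgeB {m} (u : Word m) : Word m × Word m → Set where
    orbit-edgeB : ∀ p → ¬ basB p ≡ p → ¬ p ≡ u → repB p ≡ repB u → OrbitEdgeB u (p , basB p)

  mutual
    orbitA-closed : ∀ m (u : Word m) → ¬ basA u ≡ u → Walk (OrbitEdgeA u) (basA u) u
    orbitA-closed zero    []          moved = ⊥-elim (moved refl)
    orbitA-closed (suc m) (true ∷ w)  moved = ⊥-elim (moved refl)
    orbitA-closed (suc m) (false ∷ w) moved =
      walk-bind (false ∷_) lift (orbitB-closed m w (λ eq → moved (cong (false ∷_) eq)))
      where
      lift : ∀ p q → OrbitEdgeB w (p , q) → Walk (OrbitEdgeA (false ∷ w)) (false ∷ p) (false ∷ q)
      lift p _ (orbit-edgeB _ moved′ p≢w rep) =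
        fwd (orbit-edgeA (false ∷ p) (λ eq → moved′ (∷-injectiveʳ eq)) (λ eq → p≢w (∷-injectiveʳ eq))
                         (cong (false ∷_) rep)) []

    -- b² acts on the tail as a, so one step of a below the first letter is two steps of b.
    orbitB-closed : ∀ m (u : Word m) → ¬ basB u ≡ u → Walk (OrbitEdgeB u) (basB u) u
    orbitB-closed zero    []          moved = ⊥-elim (moved refl)
    orbitB-closed (suc m) (false ∷ w) _     = fwd first rest
      where
      first : OrbitEdgeB (false ∷ w) (true ∷ basA w , false ∷ basA w)
      first = orbit-edgeB (true ∷ basA w) (basB-moves _) (λ eq → 0∷≢1∷ (sym eq)) (cong (false ∷_) (repA-basA w))
      lift : ∀ p q → OrbitEdgeA w (p , q) → Walk (OrbitEdgeB (false ∷ w)) (false ∷ p) (false ∷ q)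
      lift p _ (orbit-edgeA _ _ p≢w rep) =
        fwd (orbit-edgeB (false ∷ p) (basB-moves _) (λ eq → p≢w (∷-injectiveʳ eq)) (cong (false ∷_) rep))
            (fwd (orbit-edgeB (true ∷ basA p) (basB-moves _) (λ eq → 0∷≢1∷ (sym eq))
                              (cong (false ∷_) (trans (repA-basA p) rep))) [])
      rest : Walk (OrbitEdgeB (false ∷ w)) (false ∷ basA w) (false ∷ w)
      rest with basA w ≟W w
      ... | yes fixed rewrite fixed = []
      ... | no moved = walk-bind (false ∷_) lift (orbitA-closed m w moved)
    orbitB-closed (suc m) (true ∷ w) _ = fwd first rest
      where
      first : OrbitEdgeB (true ∷ w) (false ∷ w , true ∷ basA w)
      first = orbit-edgeB (false ∷ w) (basB-moves _) 0∷≢1∷ refl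
      lift : ∀ p q → OrbitEdgeA w (p , q) → Walk (OrbitEdgeB (true ∷ w)) (true ∷ p) (true ∷ q)
      lift p _ (orbit-edgeA _ _ p≢w rep) =
        fwd (orbit-edgeB (true ∷ p) (basB-moves _) (λ eq → p≢w (∷-injectiveʳ eq)) (cong (false ∷_) rep))
            (fwd (orbit-edgeB (false ∷ p) (basB-moves _) 0∷≢1∷ (cong (false ∷_) rep)) [])
      rest : Walk (OrbitEdgeB (true ∷ w)) (true ∷ basA w) (true ∷ w)
      rest with basA w ≟W w
      ... | yes fixed rewrite fixed = []
      ... | no moved = walk-bind (true ∷_) lift (orbitA-closed m w moved)

  data SchreierEdge {m} : Word m × Word m → Set where
    a-edge : ∀ p → ¬ basA p ≡ p → SchreierEdge (p , basA p)
    b-edge : ∀ p → ¬ basB p ≡ p → SchreierEdge (p , basB p)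

  zeros : ∀ m → Word m
  zeros zero    = []
  zeros (suc m) = false ∷ zeros m

  private
    lift-0∷ : ∀ {m} (p q : Word m) → SchreierEdge (p , q) → Walk SchreierEdge (false ∷ p) (false ∷ q)
    lift-0∷ p _ (a-edge _ _)     =
      fwd (b-edge (false ∷ p) (basB-moves _)) (fwd (b-edge (true ∷ basA p) (basB-moves _)) [])
    lift-0∷ p _ (b-edge _ moved) = fwd (a-edge (false ∷ p) (λ eq → moved (∷-injectiveʳ eq))) []

  walk-to-zeros : ∀ m (w : Word m) → Walk SchreierEdge w (zeros m)
  walk-to-zeros zero    []          = []
  walk-to-zeros (suc m) (false ∷ w) = walk-bind (false ∷_) lift-0∷ (walk-to-zeros m w)
  walk-to-zeros (suc m) (true ∷ w)  =
    fwd (b-edge (true ∷ w) (basB-moves _)) (walk-bind (false ∷_) lift-0∷ (walk-to-zeros m w))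

  orbitSizeA orbitSizeB : ∀ m → Word m → ℕ
  orbitSizeA m r = count (λ u → repA u ≟W r) (allWords m)
  orbitSizeB m r = count (λ u → repB u ≟W r) (allWords m)

  module _ (m : ℕ) where

    private
      count-allWords-suc : ∀ {P : Word (suc m) → Set} (P? : ∀ u → Dec (P u)) →
        count P? (allWords (suc m))
          ≡ count (λ w → P? (false ∷ w)) (allWords m) + count (λ w → P? (true ∷ w)) (allWords m)
      count-allWords-suc P? = trans (count-++ P? (map (false ∷_) (allWords m)) (map (true ∷_) (allWords m)))
                                    (cong₂ _+_ (count-map P? (false ∷_) (allWords m)) (count-map P? (true ∷_) (allWords m)))

    orbitSizeA-0∷ : ∀ r → orbitSizeA (suc m) (false ∷ r) ≡ orbitSizeB m r
    orbitSizeA-0∷ r = trans (count-allWords-suc (λ u → repA u ≟W (false ∷ r)))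
      (trans (cong₂ _+_ (count-cong _ _ (allWords m) (λ _ _ → ∷-injectiveʳ) (λ _ _ → cong (false ∷_)))
                        (count-none _ (allWords m) (λ _ _ eq → 0∷≢1∷ (sym eq))))
             (ℕ.+-identityʳ _))

    orbitSizeA-1∷ : ∀ r → orbitSizeA (suc m) (true ∷ r) ≡ 1
    orbitSizeA-1∷ r = trans (count-allWords-suc (λ u → repA u ≟W (true ∷ r)))
      (cong₂ _+_ (count-none _ (allWords m) (λ _ _ → 0∷≢1∷))
                 (count≡1 _ (allWords m) (allWords-unique m) (∈-allWords m r) refl (λ _ → ∷-injectiveʳ)))

    orbitSizeB-0∷ : ∀ r → orbitSizeB (suc m) (false ∷ r) ≡ orbitSizeA m r + orbitSizeA m r
    orbitSizeB-0∷ r = trans (count-allWords-suc (λ u → repB u ≟W (false ∷ r)))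
      (cong₂ _+_ (count-cong _ _ (allWords m) (λ _ _ → ∷-injectiveʳ) (λ _ _ → cong (false ∷_)))
                 (count-cong _ _ (allWords m) (λ _ _ → ∷-injectiveʳ) (λ _ _ → cong (false ∷_))))

  orbitSizeA-fixed : ∀ m r → r ∈ fixedA m → orbitSizeA m r ≡ 1
  orbitSizeA-fixed zero [] _ = refl
  orbitSizeA-fixed (suc m) r r∈ with ∈-++⁻ (map (false ∷_) (fixedB m)) r∈
  orbitSizeA-fixed (suc zero) r r∈ | inj₁ r∈₀ with ∈-map-0∷⁻ r∈₀
  ... | [] , here refl , refl = refl
  orbitSizeA-fixed (suc (suc m)) r r∈ | inj₁ r∈₀ with ∈-map-0∷⁻ r∈₀
  ... | _ , () , _
  orbitSizeA-fixed (suc m) r r∈ | inj₂ r∈₁ with ∈-map⁻ (true ∷_) r∈₁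
  ... | s , _ , refl = orbitSizeA-1∷ m s

  sumOver-orbitSizeA : ∀ m → sumOver (cyclesA m ++ fixedA m) (orbitSizeA m) ≡ length (allWords m)
  sumOver-orbitSizeA m = sumOver-fibres _≟W_ repA _ (orbitsA-unique m) (allWords m) (λ u _ → repA∈orbitsA m u)

  sumOver-orbitSizeB : ∀ m → sumOver (cyclesB m ++ fixedB m) (orbitSizeB m) ≡ length (allWords m)
  sumOver-orbitSizeB m = sumOver-fibres _≟W_ repB _ (orbitsB-unique m) (allWords m) repB∈orbits
    where
    repB∈orbits : ∀ u → u ∈ allWords m → repB u ∈ cyclesB m ++ fixedB m
    repB∈orbits u _ with repB∈orbitsB m u
    ... | inj₁ r∈ = ∈-++⁺ˡ r∈
    ... | inj₂ r∈ = ∈-++⁺ʳ (cyclesB m) r∈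

  orbit-count : ∀ m → length (cyclesA m) + length (cyclesB m) + length (fixedA m) + length (fixedB m)
                      ≡ length (allWords m) + 1
  orbit-count zero    = refl
  orbit-count (suc m) = begin
    length (map (false ∷_) (cyclesB m)) + length (map (false ∷_) (cyclesA m ++ fixedA m))
      + length (map (false ∷_) (fixedB m) ++ map (true ∷_) (allWords m)) + 0
      ≡⟨ cong₂ (λ p q → p + q + length (map (false ∷_) (fixedB m) ++ map (true ∷_) (allWords m)) + 0)
               (length-map _ (cyclesB m)) (trans (length-map _ (cyclesA m ++ fixedA m)) (length-++ (cyclesA m))) ⟩
    cB + (cA + fA) + length (map (false ∷_) (fixedB m) ++ map (true ∷_) (allWords m)) + 0
      ≡⟨ cong (λ z → cB + (cA + fA) + z + 0)
              (trans (length-++ (map (false ∷_) (fixedB m)))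
                     (cong₂ _+_ (length-map _ (fixedB m)) (length-map _ (allWords m)))) ⟩
    cB + (cA + fA) + (fB + W) + 0      ≡⟨ regroup cA cB fA fB W ⟩
    (cA + cB + fA + fB) + W            ≡⟨ cong (_+ W) (orbit-count m) ⟩
    (W + 1) + W                        ≡⟨ regroup′ W ⟩
    (W + W) + 1                        ≡⟨ cong (_+ 1) (sym (length-allWords-suc m)) ⟩
    length (allWords (suc m)) + 1      ∎
    where
    open ≡-Reasoning
    cA = length (cyclesA m)
    cB = length (cyclesB m)
    fA = length (fixedA m)
    fB = length (fixedB m)
    W  = length (allWords m)
    regroup : ∀ a b c d w → b + (a + c) + (d + w) + 0 ≡ (a + b + c + d) + w
    regroup = solve-∀
    regroup′ : ∀ w → (w + 1) + w ≡ (w + w) + 1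
    regroup′ = solve-∀

  module SchreierCactus (n : ℕ) where

    private
      N = suc n
      W = Word N

    open Cactus.Components (_≟W_ {N}) using (Edge)

    edgesAt : W → List Edge
    edgesAt u = loopless u (basA u) ++ loopless u (basB u)

    loopless⁻ : ∀ {u v : W} {e} → e ∈ loopless u v → e ≡ (u , v) × ¬ v ≡ u
    loopless⁻ {u} {v} e∈ with v ≟W u
    loopless⁻ {u} {v} ()          | yes _
    loopless⁻ {u} {v} (here refl) | no v≢u = refl , v≢u

    loopless⁺ : ∀ {u v : W} → ¬ v ≡ u → (u , v) ∈ loopless u v
    loopless⁺ {u} {v} v≢u with v ≟W u
    ... | yes v≡u = ⊥-elim (v≢u v≡u)
    ... | no _    = here refl

    schreierEdge⁺ : ∀ {e} → SchreierEdge e → e ∈ edgesB* N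
    schreierEdge⁺ (a-edge u moved) = ∈-concatMap⁺ edgesAt (lose (∈-allWords N u) (∈-++⁺ˡ (loopless⁺ moved)))
    schreierEdge⁺ (b-edge u moved) =
      ∈-concatMap⁺ edgesAt (lose (∈-allWords N u) (∈-++⁺ʳ (loopless u (basA u)) (loopless⁺ moved)))

    schreierEdge⁻ : ∀ {e} → e ∈ edgesB* N → SchreierEdge e
    schreierEdge⁻ e∈ with find (∈-concatMap⁻ edgesAt {xs = allWords N} e∈)
    ... | u , _ , e∈u with ∈-++⁻ (loopless u (basA u)) e∈u
    ...   | inj₁ e∈a with loopless⁻ e∈a
    ...     | refl , moved = a-edge u moved
    schreierEdge⁻ e∈ | u , _ , e∈u | inj₂ e∈b with loopless⁻ e∈b
    ...     | refl , moved = b-edge u moved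

    edges-unique : Unique (edgesB* N)
    edges-unique = unique-concatMap edgesAt (allWords-unique N) edgesAt-unique same-source
      where
      loopless-unique : ∀ u v → Unique (loopless u v)
      loopless-unique u v with v ≟W u
      ... | yes _ = []
      ... | no _  = [] ∷ []
      edgesAt-unique : ∀ u → Unique (edgesAt u)
      edgesAt-unique u = Unique.++⁺ (loopless-unique u (basA u)) (loopless-unique u (basB u)) disjoint
        where
        disjoint : ∀ {e} → ¬ (e ∈ loopless u (basA u) × e ∈ loopless u (basB u))
        disjoint (e∈a , e∈b) with loopless⁻ e∈a | loopless⁻ e∈b
        ... | refl , _ | eq , _ = head-basB u (trans (cong (head ∘ proj₂) (sym eq)) (head-basA u))
      source : ∀ u {e} → e ∈ edgesAt u → proj₁ e ≡ u
      source u e∈ with ∈-++⁻ (loopless u (basA u)) e∈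
      ... | inj₁ e∈a = cong proj₁ (proj₁ (loopless⁻ e∈a))
      ... | inj₂ e∈b = cong proj₁ (proj₁ (loopless⁻ e∈b))
      same-source : ∀ u v {e} → e ∈ edgesAt u → e ∈ edgesAt v → u ≡ v
      same-source u v e∈u e∈v = trans (sym (source u e∈u)) (source v e∈v)

    -- a keeps the first letter and b changes it, so the endpoints of an edge tell its generator, hence its cycle.
    cycleOf : Edge → Bool × W
    cycleOf (u , v) = if ⌊ head u ≟B head v ⌋ then (true , repA u) else (false , repB u)

    cycleOf-a : ∀ u → cycleOf (u , basA u) ≡ (true , repA u)
    cycleOf-a (false ∷ w) = refl
    cycleOf-a (true ∷ w)  = refl

    cycleOf-b : ∀ u → cycleOf (u , basB u) ≡ (false , repB u)
    cycleOf-b (false ∷ w) = refl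
    cycleOf-b (true ∷ w)  = refl

    _≟I_ : DecidableEquality (Bool × W)
    _≟I_ = ×-≡-dec _≟B_ _≟W_

    tagA tagB : W → Bool × W
    tagA r = true , r
    tagB r = false , r

    cycleIds : List (Bool × W)
    cycleIds = map tagA (cyclesA N) ++ map tagB (cyclesB N)

    cycleIds-unique : Unique cycleIds
    cycleIds-unique =
      Unique.++⁺ (Unique.map⁺ (cong proj₂) (unique-++⁻ˡ (cyclesA N) (orbitsA-unique N)))
                 (Unique.map⁺ (cong proj₂) (unique-++⁻ˡ (cyclesB N) (orbitsB-unique N)))
                 disjoint
      where
      disjoint : ∀ {j} → ¬ (j ∈ map tagA (cyclesA N) × j ∈ map tagB (cyclesB N))
      disjoint (j∈A , j∈B) with ∈-map⁻ tagA j∈A | ∈-map⁻ tagB j∈B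
      ... | _ , _ , refl | _ , _ , ()

    open Cactus.CycleDecomposition (_≟W_ {N}) (allWords N) (allWords-unique N) (∈-allWords N)
                                   _≟I_ cycleIds cycleIds-unique cycleOf

    private
      countOn-edgesAt-a : ∀ r → ¬ basA r ≡ r → ∀ u →
                          countOn (true , r) (edgesAt u) ≡ (if ⌊ repA u ≟W r ⌋ then 1 else 0)
      countOn-edgesAt-a r r-moves u =
        trans (count-++ (λ e → cycleOf e ≟I (true , r)) (loopless u (basA u)) (loopless u (basB u)))
              (trans (cong₂ _+_ a-part b-part) (ℕ.+-identityʳ _))
        where
        a-part : countOn (true , r) (loopless u (basA u)) ≡ (if ⌊ repA u ≟W r ⌋ then 1 else 0)
        a-part with basA u ≟W u | repA u ≟W r
        ... | yes fixed | yes rep =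
          ⊥-elim (r-moves (subst (λ z → basA z ≡ z) (trans (sym (repA-fixed u fixed)) rep) fixed))
        ... | yes _     | no _    = refl
        ... | no _      | yes rep = count-accept (λ e → cycleOf e ≟I (true , r)) [] (trans (cycleOf-a u) (cong tagA rep))
        ... | no _      | no ¬rep = count-reject (λ e → cycleOf e ≟I (true , r)) []
                                                 (λ eq → ¬rep (cong proj₂ (trans (sym (cycleOf-a u)) eq)))
        b-part : countOn (true , r) (loopless u (basB u)) ≡ 0
        b-part with basB u ≟W u
        ... | yes _ = refl
        ... | no _  = count-reject (λ e → cycleOf e ≟I (true , r)) []
                                   (λ eq → case cong proj₁ (trans (sym (cycleOf-b u)) eq) of λ ())

      countOn-edgesAt-b : ∀ r u → countOn (false , r) (edgesAt u) ≡ (if ⌊ repB u ≟W r ⌋ then 1 else 0)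
      countOn-edgesAt-b r u =
        trans (count-++ (λ e → cycleOf e ≟I (false , r)) (loopless u (basA u)) (loopless u (basB u)))
              (cong₂ _+_ a-part b-part)
        where
        a-part : countOn (false , r) (loopless u (basA u)) ≡ 0
        a-part with basA u ≟W u
        ... | yes _ = refl
        ... | no _  = count-reject (λ e → cycleOf e ≟I (false , r)) []
                                   (λ eq → case cong proj₁ (trans (sym (cycleOf-a u)) eq) of λ ())
        b-part : countOn (false , r) (loopless u (basB u)) ≡ (if ⌊ repB u ≟W r ⌋ then 1 else 0)
        b-part with basB u ≟W u | repB u ≟W r
        ... | yes fixed | _       = ⊥-elim (basB-moves u fixed)
        ... | no _      | yes rep = count-accept (λ e → cycleOf e ≟I (false , r)) [] (trans (cycleOf-b u) (cong tagB rep))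
        ... | no _      | no ¬rep = count-reject (λ e → cycleOf e ≟I (false , r)) []
                                                 (λ eq → ¬rep (cong proj₂ (trans (sym (cycleOf-b u)) eq)))

    countOn-a : ∀ r → ¬ basA r ≡ r → countOn (true , r) (edgesB* N) ≡ orbitSizeA N r
    countOn-a r r-moves =
      trans (count-concatMap (λ e → cycleOf e ≟I (true , r)) edgesAt (allWords N))
            (trans (sumOver-cong (allWords N) (λ u _ → countOn-edgesAt-a r r-moves u))
                   (sumOver-indicator (λ u → repA u ≟W r) (allWords N)))

    countOn-b : ∀ r → countOn (false , r) (edgesB* N) ≡ orbitSizeB N r
    countOn-b r =
      trans (count-concatMap (λ e → cycleOf e ≟I (false , r)) edgesAt (allWords N))
            (trans (sumOver-cong (allWords N) (λ u _ → countOn-edgesAt-b r u))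
                   (sumOver-indicator (λ u → repB u ≟W r) (allWords N)))

    private
      E = edgesB* N

      cycleId-a : ∀ u → ¬ basA u ≡ u → (true , repA u) ∈ cycleIds
      cycleId-a u moved = ∈-++⁺ˡ (∈-map⁺ tagA (repA∈cyclesA N u moved))

      cycleId-b : ∀ u → (false , repB u) ∈ cycleIds
      cycleId-b u = ∈-++⁺ʳ (map tagA (cyclesA N)) (∈-map⁺ tagB (repB∈cyclesB N u (basB-moves u)))

    edges-on-cycles : OnCycles E
    edges-on-cycles = All.tabulate (on-cycle ∘ schreierEdge⁻)
      where
      on-cycle : ∀ {e} → SchreierEdge e → cycleOf e ∈ cycleIds
      on-cycle (a-edge u moved) = subst (_∈ cycleIds) (sym (cycleOf-a u)) (cycleId-a u moved)
      on-cycle (b-edge u _)     = subst (_∈ cycleIds) (sym (cycleOf-b u)) (cycleId-b u)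

    cycle-nonempty : ∀ j → j ∈ cycleIds → 1 ≤ countOn j E
    cycle-nonempty j j∈ with ∈-++⁻ (map tagA (cyclesA N)) j∈
    ... | inj₁ j∈A with ∈-map⁻ tagA j∈A
    ...   | r , r∈ , refl = let rep , moved = cyclesA-rep N r r∈ in
            count-pos _ E (schreierEdge⁺ (a-edge r moved)) (trans (cycleOf-a r) (cong tagA rep))
    cycle-nonempty j j∈ | inj₂ j∈B with ∈-map⁻ tagB j∈B
    ...   | r , r∈ , refl = let rep , moved = cyclesB-rep N r r∈ in
            count-pos _ E (schreierEdge⁺ (b-edge r moved)) (trans (cycleOf-b r) (cong tagB rep))

    cycle-closed : ∀ e → e ∈ E → Walk (OtherEdgeOnCycle E e) (proj₁ e) (proj₂ e)
    cycle-closed e e∈ with schreierEdge⁻ e∈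
    ... | a-edge u moved = walk-map other (walk-reverse (orbitA-closed N u moved))
      where
      other : ∀ e′ → OrbitEdgeA u e′ → OtherEdgeOnCycle E (u , basA u) e′
      other _ (orbit-edgeA p moved′ p≢u rep) =
        schreierEdge⁺ (a-edge p moved′) , trans (cycleOf-a p) (trans (cong tagA rep) (sym (cycleOf-a u)))
        , (λ eq → p≢u (cong proj₁ eq))
    ... | b-edge u moved = walk-map other (walk-reverse (orbitB-closed N u moved))
      where
      other : ∀ e′ → OrbitEdgeB u e′ → OtherEdgeOnCycle E (u , basB u) e′
      other _ (orbit-edgeB p moved′ p≢u rep) =
        schreierEdge⁺ (b-edge p moved′) , trans (cycleOf-b p) (trans (cong tagB rep) (sym (cycleOf-b u)))
        , (λ eq → p≢u (cong proj₁ eq))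

    connected : ∀ w → Walk (_∈ E) w (zeros N)
    connected w = walk-map (λ _ → schreierEdge⁺) (walk-to-zeros N w)

    private
      sumOver-countOn-cycleIds : sumOver cycleIds (λ j → countOn j E)
                                 ≡ sumOver (cyclesA N) (orbitSizeA N) + sumOver (cyclesB N) (orbitSizeB N)
      sumOver-countOn-cycleIds =
        trans (sumOver-++ (map tagA (cyclesA N)) (map tagB (cyclesB N)) (λ j → countOn j E))
              (cong₂ _+_ (trans (sumOver-map tagA (cyclesA N) (λ j → countOn j E))
                                (sumOver-cong (cyclesA N) (λ r r∈ → countOn-a r (proj₂ (cyclesA-rep N r r∈)))))
                         (trans (sumOver-map tagB (cyclesB N) (λ j → countOn j E))
                                (sumOver-cong (cyclesB N) (λ r _ → countOn-b r))))

      length-cycleIds : length cycleIds ≡ length (cyclesA N) + length (cyclesB N)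
      length-cycleIds = trans (length-++ (map tagA (cyclesA N)))
                              (cong₂ _+_ (length-map tagA (cyclesA N)) (length-map tagB (cyclesB N)))

    -- Both sides equal 2·2ᴺ - |fixedA N| + 1, by summing orbit sizes and counting orbits (b has no fixed points).
    cyclomatic : length E + 1 ≡ length (allWords N) + length cycleIds
    cyclomatic = ℕ.+-cancelʳ-≡ fA _ _ (begin
      (length E + 1) + fA
        ≡⟨ cong (λ z → z + 1 + fA) (trans (sym (sumOver-countOn E edges-on-cycles)) sumOver-countOn-cycleIds) ⟩
      (ΣA + ΣB + 1) + fA                    ≡⟨ regroup ΣA ΣB fA ⟩
      (ΣA + fA) + ΣB + 1                    ≡⟨ cong₂ (λ p q → p + q + 1) sizesA sizesB ⟩
      V + V + 1                             ≡⟨ ℕ.+-assoc V V 1 ⟩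
      V + (V + 1)                           ≡⟨ cong (V +_) (sym (orbit-count N)) ⟩
      V + (cA + cB + fA + 0)                ≡⟨ regroup′ V cA cB fA ⟩
      (V + (cA + cB)) + fA                  ≡⟨ cong (λ z → V + z + fA) (sym length-cycleIds) ⟩
      (V + length cycleIds) + fA            ∎)
      where
      open ≡-Reasoning
      ΣA = sumOver (cyclesA N) (orbitSizeA N)
      ΣB = sumOver (cyclesB N) (orbitSizeB N)
      V  = length (allWords N)
      cA = length (cyclesA N)
      cB = length (cyclesB N)
      fA = length (fixedA N)
      sizesA : ΣA + fA ≡ V
      sizesA = trans (cong (ΣA +_) (sym (trans (sumOver-cong (fixedA N) (orbitSizeA-fixed N)) (sumOver-const1 (fixedA N)))))
                     (trans (sym (sumOver-++ (cyclesA N) (fixedA N) (orbitSizeA N))) (sumOver-orbitSizeA N))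
      sizesB : ΣB ≡ V
      sizesB = trans (sym (ℕ.+-identityʳ ΣB))
                     (trans (sym (sumOver-++ (cyclesB N) [] (orbitSizeB N))) (sumOver-orbitSizeB N))
      regroup : ∀ a b f → (a + b + 1) + f ≡ (a + f) + b + 1
      regroup = solve-∀
      regroup′ : ∀ v a b f → v + (a + b + f + 0) ≡ (v + (a + b)) + f
      regroup′ = solve-∀

    isCactus : IsCactus E
    isCactus = record
      { edges-unique    = edges-unique
      ; edges-on-cycles = edges-on-cycles
      ; cycle-nonempty  = cycle-nonempty
      ; cycle-closed    = cycle-closed
      ; root            = zeros N
      ; connected       = connected
      ; cyclomatic      = cyclomatic
      }

    tutteB*≡orbitProduct : ∀ x y → tutteB* N x y
      ≡ prodOver (cyclesA N) (λ r → geo (orbitSizeA N r) x y) ℤ.* prodOver (cyclesB N) (λ r → geo (orbitSizeB N r) x y)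
    tutteB*≡orbitProduct x y = begin
      tutteB* N x y                                         ≡⟨ tutte-cactus isCactus x y ⟩
      prodOver cycleIds g                                   ≡⟨ prodOver-++ (map tagA (cyclesA N)) (map tagB (cyclesB N)) g ⟩
      prodOver (map tagA (cyclesA N)) g ℤ.* prodOver (map tagB (cyclesB N)) g
        ≡⟨ cong₂ ℤ._*_ (trans (prodOver-map tagA (cyclesA N) g) (prodOver-cong (cyclesA N) a-cycle))
                       (trans (prodOver-map tagB (cyclesB N) g) (prodOver-cong (cyclesB N) b-cycle)) ⟩
      prodOver (cyclesA N) (λ r → geo (orbitSizeA N r) x y) ℤ.* prodOver (cyclesB N) (λ r → geo (orbitSizeB N r) x y) ∎
      where
      open ≡-Reasoning
      g : Bool × W → ℤ
      g j = geo (countOn j E) x y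
      a-cycle : ∀ r → r ∈ cyclesA N → g (tagA r) ≡ geo (orbitSizeA N r) x y
      a-cycle r r∈ = cong (λ c → geo c x y) (countOn-a r (proj₂ (cyclesA-rep N r r∈)))
      b-cycle : ∀ r → r ∈ cyclesB N → g (tagB r) ≡ geo (orbitSizeB N r) x y
      b-cycle r _ = cong (λ c → geo c x y) (countOn-b r)

module ClosedForm where

  open import Data.Nat as ℕ using (ℕ; zero; suc; _∸_)
  import Data.Nat.Properties as ℕ
  open import Data.Nat.Tactic.RingSolver as ℕ-Solver using ()
  open import Data.Integer using (ℤ; _*_; _^_; 1ℤ)
  open import Data.Integer.Properties using (*-comm; *-assoc; ^-distribˡ-+-*; *-commutativeSemigroup)
  open import Data.Integer.Tactic.RingSolver using (solve-∀)
  open import Algebra.Properties.CommutativeSemigroup *-commutativeSemigroup using (interchange)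
  open import Data.List using (_++_; map; length)
  open import Data.List.Properties using (length-++; length-map)
  open import Data.Vec using (_∷_)
  open import Data.Bool using (false)
  open import Relation.Binary.PropositionalEquality
  open import Defs using (prodFrom1; allWords; tutteB*; geo)
  open Counting
  open Products
  open Basilica

  orbitProductA orbitProductB fixedProduct orbitProduct : ℕ → (ℕ → ℤ) → ℤ
  orbitProductA m f = prodOver (cyclesA m) (λ r → f (orbitSizeA m r))
  orbitProductB m f = prodOver (cyclesB m) (λ r → f (orbitSizeB m r))
  fixedProduct  m f = prodOver (fixedA m) (λ r → f (orbitSizeA m r))
  orbitProduct  m f = orbitProductA m f * orbitProductB m f

  tutteB*≡orbitProduct : ∀ n x y → tutteB* (suc n) x y ≡ orbitProduct (suc n) (λ c → geo c x y)
  tutteB*≡orbitProduct n = SchreierCactus.tutteB*≡orbitProduct n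

  doubling : (ℕ → ℤ) → ℕ → ℤ
  doubling f c = f (2 ℕ.* c)

  orbitProductA-suc : ∀ m f → orbitProductA (suc m) f ≡ orbitProductB m f
  orbitProductA-suc m f = trans (prodOver-map (false ∷_) (cyclesB m) (λ r → f (orbitSizeA (suc m) r)))
                                (prodOver-cong (cyclesB m) (λ r _ → cong f (orbitSizeA-0∷ m r)))

  orbitProductB-suc : ∀ m f → orbitProductB (suc m) f ≡ orbitProductA m (doubling f) * fixedProduct m (doubling f)
  orbitProductB-suc m f =
    trans (prodOver-map (false ∷_) (cyclesA m ++ fixedA m) (λ r → f (orbitSizeB (suc m) r)))
          (trans (prodOver-cong (cyclesA m ++ fixedA m) (λ r _ → cong f (twice r)))
                 (prodOver-++ (cyclesA m) (fixedA m) (λ r → doubling f (orbitSizeA m r))))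
    where
    twice : ∀ r → orbitSizeB (suc m) (false ∷ r) ≡ 2 ℕ.* orbitSizeA m r
    twice r = trans (orbitSizeB-0∷ m r) (cong (orbitSizeA m r ℕ.+_) (sym (ℕ.+-identityʳ _)))

  fixedProduct-const : ∀ m f → fixedProduct m f ≡ f 1 ^ length (fixedA m)
  fixedProduct-const m f = trans (prodOver-cong (fixedA m) (λ r r∈ → cong f (orbitSizeA-fixed m r r∈)))
                                 (prodOver-const (fixedA m) (f 1))

  -- Two levels down every cycle reappears with twice its length, and each fixed point of a on levels m and
  -- m + 1 gives a new 2-cycle.
  orbitProduct-suc-suc : ∀ m f → orbitProduct (suc (suc m)) f
                         ≡ orbitProduct m (doubling f) * f 2 ^ (length (fixedA m) ℕ.+ length (fixedA (suc m)))
  orbitProduct-suc-suc m f = begin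
    orbitProductA (suc (suc m)) f * orbitProductB (suc (suc m)) f
      ≡⟨ cong₂ _*_ (trans (orbitProductA-suc (suc m) f) (orbitProductB-suc m f))
                   (trans (orbitProductB-suc (suc m) f) (cong (_* fixedProduct (suc m) g) (orbitProductA-suc m g))) ⟩
    (orbitProductA m g * fixedProduct m g) * (orbitProductB m g * fixedProduct (suc m) g)
      ≡⟨ interchange (orbitProductA m g) (fixedProduct m g) (orbitProductB m g) (fixedProduct (suc m) g) ⟩
    orbitProduct m g * (fixedProduct m g * fixedProduct (suc m) g)
      ≡⟨ cong (orbitProduct m g *_) (cong₂ _*_ (fixedProduct-const m g) (fixedProduct-const (suc m) g)) ⟩
    orbitProduct m g * (f 2 ^ length (fixedA m) * f 2 ^ length (fixedA (suc m)))
      ≡⟨ cong (orbitProduct m g *_) (sym (^-distribˡ-+-* (f 2) (length (fixedA m)) _)) ⟩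
    orbitProduct m g * f 2 ^ (length (fixedA m) ℕ.+ length (fixedA (suc m))) ∎
    where
    open ≡-Reasoning
    g = doubling f

  length-fixedA-suc : ∀ m → length (fixedA (suc m)) ≡ length (fixedB m) ℕ.+ 2 ℕ.^ m
  length-fixedA-suc m = trans (length-++ (map (false ∷_) (fixedB m)))
                              (cong₂ ℕ._+_ (length-map _ (fixedB m)) (trans (length-map _ (allWords m)) (length-allWords m)))

  fixed-points-two-levels : ∀ k →
    length (fixedA (suc (suc k))) ℕ.+ length (fixedA (suc (suc (suc k)))) ≡ 3 ℕ.* 2 ℕ.^ suc k
  fixed-points-two-levels k =
    trans (cong₂ ℕ._+_ (length-fixedA-suc (suc k)) (length-fixedA-suc (suc (suc k)))) (three-halves (2 ℕ.^ suc k))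
    where
    three-halves : ∀ p → 0 ℕ.+ p ℕ.+ (0 ℕ.+ 2 ℕ.* p) ≡ 3 ℕ.* p
    three-halves = ℕ-Solver.solve-∀

  orbitProduct-1 : ∀ f → orbitProduct 1 f ≡ f 2
  orbitProduct-1 f = unit (f 2)
    where
    unit : ∀ a → 1ℤ * (a * 1ℤ) ≡ a
    unit = solve-∀

  basProdWith : ℕ → ℕ → (ℕ → ℤ) → ℤ
  basProdWith n K f = prodFrom1 K (λ i → f (2 ℕ.^ i) ^ (3 ℕ.* 2 ℕ.^ (n ∸ 2 ℕ.* i ∸ 1)))

  prodFrom1-cong : ∀ K {h h′ : ℕ → ℤ} → (∀ i → h i ≡ h′ i) → prodFrom1 K h ≡ prodFrom1 K h′
  prodFrom1-cong zero    e = refl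
  prodFrom1-cong (suc K) e = cong₂ _*_ (prodFrom1-cong K e) (e (suc K))

  prodFrom1-suc : ∀ K (h : ℕ → ℤ) → prodFrom1 (suc K) h ≡ h 1 * prodFrom1 K (λ i → h (suc i))
  prodFrom1-suc zero    h = *-comm 1ℤ (h 1)
  prodFrom1-suc (suc K) h = trans (cong (_* h (suc (suc K))) (prodFrom1-suc K h))
                                  (*-assoc (h 1) (prodFrom1 K (λ i → h (suc i))) (h (suc (suc K))))

  basProdWith-suc : ∀ n K f →
    basProdWith (suc (suc n)) (suc K) f ≡ f 2 ^ (3 ℕ.* 2 ℕ.^ (n ∸ 1)) * basProdWith n K (doubling f)
  basProdWith-suc n K f =
    trans (prodFrom1-suc K _) (cong (f 2 ^ (3 ℕ.* 2 ℕ.^ (n ∸ 1)) *_) (prodFrom1-cong K exponent))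
    where
    exponent : ∀ i → f (2 ℕ.^ suc i) ^ (3 ℕ.* 2 ℕ.^ (suc (suc n) ∸ 2 ℕ.* suc i ∸ 1))
                     ≡ doubling f (2 ℕ.^ i) ^ (3 ℕ.* 2 ℕ.^ (n ∸ 2 ℕ.* i ∸ 1))
    exponent i = cong (λ z → f (2 ℕ.^ suc i) ^ (3 ℕ.* 2 ℕ.^ (suc (suc n) ∸ z ∸ 1))) (ℕ.*-suc 2 i)

  orbitProduct-two-levels : ∀ k f →
    orbitProduct (4 ℕ.+ k) f ≡ orbitProduct (2 ℕ.+ k) (doubling f) * f 2 ^ (3 ℕ.* 2 ℕ.^ suc k)
  orbitProduct-two-levels k f =
    trans (orbitProduct-suc-suc (2 ℕ.+ k) f)
          (cong (λ e → orbitProduct (2 ℕ.+ k) (doubling f) * f 2 ^ e) (fixed-points-two-levels k))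

  closed-form-step : ∀ k m f X → orbitProduct (2 ℕ.+ k) (doubling f) ≡ X * basProdWith (2 ℕ.+ k) m (doubling f) →
                     orbitProduct (4 ℕ.+ k) f ≡ X * basProdWith (4 ℕ.+ k) (suc m) f
  closed-form-step k m f X hyp = begin
    orbitProduct (4 ℕ.+ k) f                   ≡⟨ orbitProduct-two-levels k f ⟩
    orbitProduct (2 ℕ.+ k) (doubling f) * F    ≡⟨ cong (_* F) hyp ⟩
    X * basProdWith (2 ℕ.+ k) m (doubling f) * F
      ≡⟨ reassociate X (basProdWith (2 ℕ.+ k) m (doubling f)) F ⟩
    X * (F * basProdWith (2 ℕ.+ k) m (doubling f))
      ≡⟨ cong (X *_) (sym (basProdWith-suc (2 ℕ.+ k) m f)) ⟩
    X * basProdWith (4 ℕ.+ k) (suc m) f        ∎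
    where
    open ≡-Reasoning
    F = f 2 ^ (3 ℕ.* 2 ℕ.^ suc k)
    reassociate : ∀ a b c → (a * b) * c ≡ a * (c * b)
    reassociate = solve-∀

  orbitProduct-even : ∀ m f → orbitProduct (suc m ℕ.* 2) f ≡ f (2 ℕ.^ suc m) ^ 3 * basProdWith (suc m ℕ.* 2) m f
  orbitProduct-even zero    f = trans (orbitProduct-suc-suc 0 f) (swap (f 2 ^ 3))
    where
    swap : ∀ p → 1ℤ * p ≡ p * 1ℤ
    swap = solve-∀
  orbitProduct-even (suc m) f =
    closed-form-step (m ℕ.* 2) m f (f (2 ℕ.^ suc (suc m)) ^ 3) (orbitProduct-even m (doubling f))

  orbitProduct-odd : ∀ m f → orbitProduct (suc (suc m ℕ.* 2)) f
                     ≡ f (2 ℕ.^ suc m) ^ 4 * f (2 ℕ.^ suc (suc m)) * basProdWith (suc (suc m ℕ.* 2)) m f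
  orbitProduct-odd zero    f = begin
    orbitProduct 3 f                       ≡⟨ orbitProduct-suc-suc 1 f ⟩
    orbitProduct 1 (doubling f) * f 2 ^ 4  ≡⟨ cong (_* f 2 ^ 4) (orbitProduct-1 (doubling f)) ⟩
    f 4 * f 2 ^ 4                          ≡⟨ swap (f 2 ^ 4) (f 4) ⟩
    f 2 ^ 4 * f 4 * 1ℤ                     ∎
    where
    open ≡-Reasoning
    swap : ∀ p q → q * p ≡ p * q * 1ℤ
    swap = solve-∀
  orbitProduct-odd (suc m) f =
    closed-form-step (suc (m ℕ.* 2)) m f (f (2 ℕ.^ suc (suc m)) ^ 4 * f (2 ℕ.^ suc (suc (suc m))))
                     (orbitProduct-odd m (doubling f))

open import Defs
open import Data.Nat as ℕ using (ℕ; _≤_; _∸_; _/_; _%_; zero; suc; s≤s; z≤n)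
import Data.Nat.Properties as ℕ
open import Data.Nat.DivMod using (m≡m%n+[m/n]*n)
open import Data.Integer using (ℤ; _+_; _*_; _^_; 0ℤ; 1ℤ)
open import Data.Integer.Properties using (*-identityʳ)
open import Data.Integer.Tactic.RingSolver using (solve-∀)
open import Data.Product using (_×_; _,_; ∃-syntax)
open import Data.Empty using (⊥-elim)
open import Relation.Binary.PropositionalEquality
open ClosedForm

even-split : ∀ n → 2 ≤ n → n % 2 ≡ 0 → ∃[ m ] n ≡ suc m ℕ.* 2 × n / 2 ≡ suc m
even-split n 2≤n n%2≡0 with n / 2 | m≡m%n+[m/n]*n n 2
... | zero  | n≡ = ⊥-elim (ℕ.<⇒≢ (ℕ.<-≤-trans (s≤s z≤n) 2≤n) (sym (trans n≡ (cong (ℕ._+ 0) n%2≡0))))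
... | suc m | n≡ = m , trans n≡ (cong (ℕ._+ suc m ℕ.* 2) n%2≡0) , refl

odd-split : ∀ n → 2 ≤ n → n % 2 ≡ 1 → ∃[ m ] n ≡ suc (suc m ℕ.* 2) × n / 2 ≡ suc m
odd-split n 2≤n n%2≡1 with n / 2 | m≡m%n+[m/n]*n n 2
... | zero  | n≡ = ⊥-elim (ℕ.<⇒≢ 2≤n (sym (trans n≡ (cong (ℕ._+ 0) n%2≡1))))
... | suc m | n≡ = m , trans n≡ (cong (ℕ._+ suc m ℕ.* 2) n%2≡1) , refl

geo-2 : ∀ x y → geo 2 x y ≡ x + y
geo-2 x y = commute x y
  where
  commute : ∀ x y → y + (0ℤ + x * 1ℤ) ≡ x + y
  commute = solve-∀

tutteB*-odd : ∀ n → 2 ≤ n → n % 2 ≡ 1 → ∀ x y → tutteB* n x y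
              ≡ geo (2 ℕ.^ (n / 2)) x y ^ 4 * geo (2 ℕ.^ (n / 2 ℕ.+ 1)) x y * basProd n (n / 2 ∸ 1) x y
tutteB*-odd n 2≤n n-odd x y with odd-split n 2≤n n-odd
... | m , refl , half rewrite half | ℕ.+-comm m 1 =
  trans (tutteB*≡orbitProduct (suc m ℕ.* 2) x y) (orbitProduct-odd m (λ c → geo c x y))

tutteB*-even : ∀ n → 2 ≤ n → n % 2 ≡ 0 → ∀ x y → tutteB* n x y
               ≡ geo (2 ℕ.^ (n / 2)) x y ^ 3 * basProd n (n / 2 ∸ 1) x y
tutteB*-even n 2≤n n-even x y with even-split n 2≤n n-even
... | m , refl , half rewrite half =
  trans (tutteB*≡orbitProduct (suc (m ℕ.* 2)) x y) (orbitProduct-even m (λ c → geo c x y))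

mainTheorem18 : (∀ (n : ℕ) → 4 ≤ n → n % 2 ≡ 1 → ∀ (x y : ℤ) →
    tutteB* n x y
    ≡ (geo (2 ℕ.^ (n / 2)) x y ^ 4) * geo (2 ℕ.^ ((n / 2) ℕ.+ 1)) x y
    * basProd n ((n / 2) ∸ 1) x y)
    × (∀ (n : ℕ) → 4 ≤ n → n % 2 ≡ 0 → ∀ (x y : ℤ) →
    tutteB* n x y
    ≡ (geo (2 ℕ.^ (n / 2)) x y ^ 3) * basProd n ((n / 2) ∸ 1) x y)
    × (∀ (x y : ℤ) → tutteB* 1 x y ≡ x + y)
    × (∀ (x y : ℤ) → tutteB* 2 x y ≡ (x + y) ^ 3)
    × (∀ (x y : ℤ) → tutteB* 3 x y ≡ ((x + y) ^ 4) * geo 4 x y)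
mainTheorem18 =
    (λ n 4≤n → tutteB*-odd n (4≤⇒2≤ 4≤n))
  , (λ n 4≤n → tutteB*-even n (4≤⇒2≤ 4≤n))
  , (λ x y → trans (tutteB*≡orbitProduct 0 x y) (trans (orbitProduct-1 (λ c → geo c x y)) (geo-2 x y)))
  , (λ x y → trans (tutteB*-even 2 ℕ.≤-refl refl x y) (trans (*-identityʳ _) (cong (_^ 3) (geo-2 x y))))
  , (λ x y → trans (tutteB*-odd 3 (s≤s (s≤s z≤n)) refl x y)
                   (trans (*-identityʳ _) (cong (λ s → s ^ 4 * geo 4 x y) (geo-2 x y))))
  where
  4≤⇒2≤ : ∀ {n} → 4 ≤ n → 2 ≤ n
  4≤⇒2≤ = ℕ.≤-trans (s≤s (s≤s z≤n))
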